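{- Let $\mathcal A$ and $\mathcal B$ be labeled combinatorial classes with $\mathcal A=\mathrm{SEQ}(\mathcal B)$. Suppose that the counting sequence $(\mathfrak a_n)$ of $\mathcal A$ is $p$-periodic for some positive integer $p$ and that the sequence $\big(\mathfrak a_{pn}/(pn)!\big)_n$ is gargantuan. Then for every positive integer $m$, for a uniformly random object $a\in\mathcal A$ of size $pn$, \[ \mathbb P(a\text{ has }m\ \mathrm{SEQ}\text{ -irreducible parts})\approx\sum_{k\ge0}d_{pk,m}\binom{pn}{pk}\frac{\mathfrak a_{p(n-k)}}{\mathfrak a_{pn}},\qquad d_{pk,m}=m\Big(\mathfrak b_{pk}^{(m-1)}-2\mathfrak b_{pk}^{(m)}+\mathfrak b_{pk}^{(m+1)}\Big). \] In particular, \[ \mathbb P(a\text{ is }\mathrm{SEQ}\text{ -irreducible})\approx1-\sum_{k\ge1}\Big(2\mathfrak b_{pk}-\mathfrak b_{pk}^{(2)}\Big)\binom{pn}{pk}\frac{\mathfrak a_{p(n-k)}}{\mathfrak a_{pn}}. \]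
   Context: A labeled combinatorial class is a collection of objects of finite size $n$ with atoms labeled bijectively by $[n]$, stable under relabeling, with $\mathfrak a_n$ objects of size $n$; EGF $\sum\mathfrak a_nz^n/n!$. For a labeled class $\mathcal B$ with $\mathfrak b_0=0$, $\mathcal B^m$ is the labeled product of $m$ copies (EGF $B(z)^m$) and $\mathrm{SEQ}(\mathcal B)=\sum_{m\ge0}\mathcal B^m$; an object of $\mathrm{SEQ}(\mathcal B)$ lying in $\mathcal B^m$ has $m$ $\mathrm{SEQ}$-irreducible parts ($m=1$: $\mathrm{SEQ}$-irreducible). $\mathfrak b_n^{(m)}$ is the number of objects of size $n$ in $\mathcal B^m$, with $\mathfrak b_0^{(0)}=1$, $\mathfrak b_n^{(0)}=0$ for $n>0$. A sequence $(\mathfrak a_n)$ is $p$-periodic if $\mathfrak a_n\neq0$ for $n=pk$ with $k$ sufficiently large and $\mathfrak a_n=0$ for all other $n$ (in particular for all $n$ not divisible by $p$). A sequence $(a_n)$ is gargantuan if $a_{n-1}/a_n\to0$ and for every positive integer $r$, $\sum_{k=r}^{n-r}|a_ka_{n-k}|=O(a_{n-r})$. Random objects of a given size are uniform. Notation: $x_n\approx\sum_{k\ge m}c_kf_k(n)$ means that for every $r\ge m$, $x_n=\sum_{k=m}^r c_kf_k(n)+O(f_{r+1}(n))$, and $f_{k+1}(n)=o(f_k(n))$ for every $k\ge m$ (the $c_k$ may be zero). -}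

module Defs where

open import Data.Nat as ℕ using (ℕ; zero; suc)
open import Data.Nat.Divisibility using () renaming (_∣_ to _divides_)
open import Data.Nat.Combinatorics using (_C_)
open import Data.Integer as ℤ using (ℤ; +_)
open import Data.Rational using (ℚ; _/_; 0ℚ; 1ℚ; _+_; _-_; _*_; -_; ∣_∣; _≤_; _<_)
open import Data.Bool using (true; false)
open import Data.Product using (Σ; _×_; ∃-syntax)
open import Relation.Binary.PropositionalEquality using (_≡_)
open import Relation.Nullary using (¬_)

sumℕ : ℕ → (ℕ → ℕ) → ℕ
sumℕ zero    f = f 0
sumℕ (suc r) f = sumℕ r f ℕ.+ f (suc r)

sumℚ : ℕ → (ℕ → ℚ) → ℚ
sumℚ zero    f = f 0
sumℚ (suc r) f = sumℚ r f + f (suc r)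

sumℚFromTo : ℕ → ℕ → (ℕ → ℚ) → ℚ
sumℚFromTo lo zero    f with lo
... | zero  = f 0
... | suc _ = 0ℚ
sumℚFromTo lo (suc hi) f with lo ℕ.≤ᵇ suc hi
... | true  = sumℚFromTo lo hi f + f (suc hi)
... | false = 0ℚ

ℕtoℚ : ℕ → ℚ
ℕtoℚ n = + n / 1

-- x / d as a rational, with the convention x / 0 = 0 (only used where d ≠ 0 eventually)
fromℤ : ℤ → ℚ
fromℤ z = z / 1

ratio : ℕ → ℕ → ℚ
ratio x zero    = 0ℚ
ratio x (suc d) = + x / suc d

-- A labeled class 𝓑 is represented by its counting sequence b (b n = 𝔟_n).
-- Counting sequence of the labeled product 𝓑^m:
--   𝔟^{(0)}_n = [n = 0],  𝔟^{(m+1)}_n = Σ_{j=0}^{n} C(n,j) 𝔟_j 𝔟^{(m)}_{n-j}.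
bpow : (ℕ → ℕ) → ℕ → ℕ → ℕ
bpow b zero    zero    = 1
bpow b zero    (suc n) = 0
bpow b (suc m) n       = sumℕ n (λ j → (n C j) ℕ.* b j ℕ.* bpow b m (n ℕ.∸ j))

-- Counting sequence of SEQ(𝓑) = Σ_{m ≥ 0} 𝓑^m.  When b 0 = 0, 𝔟^{(m)}_n = 0 for m > n,
-- so the sum may be truncated at m = n.
seqCount : (ℕ → ℕ) → ℕ → ℕ
seqCount b n = sumℕ n (λ m → bpow b m n)

Periodic : ℕ → (ℕ → ℕ) → Set
Periodic p a = (∃[ K ] ((k : ℕ) → K ℕ.≤ k → ¬ (a (p ℕ.* k) ≡ 0)))
             × ((n : ℕ) → ¬ (p divides n) → a n ≡ 0)

BigO : (ℕ → ℚ) → (ℕ → ℚ) → Set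
BigO x f = ∃[ C ] ∃[ N ] ((n : ℕ) → N ℕ.≤ n → ∣ x n ∣ ≤ C * ∣ f n ∣)

LittleO : (ℕ → ℚ) → (ℕ → ℚ) → Set
LittleO x f = (ε : ℚ) → 0ℚ < ε → ∃[ N ] ((n : ℕ) → N ℕ.≤ n → ∣ x n ∣ ≤ ε * ∣ f n ∣)

-- gargantuan sequence (a_n):  a_{n-1}/a_n → 0 (stated multiplicatively, together with
-- a_n ≠ 0 eventually so that the ratio is defined), and for every r ≥ 1,
-- Σ_{k=r}^{n-r} |a_k a_{n-k}| = O(a_{n-r}).
Gargantuan : (ℕ → ℚ) → Set
Gargantuan a =
  (∃[ N ] ((n : ℕ) → N ℕ.≤ n → ¬ (a n ≡ 0ℚ)))
  × LittleO (λ n → a (n ℕ.∸ 1)) a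
  × ((r : ℕ) → 1 ℕ.≤ r →
       BigO (λ n → sumℚFromTo r (n ℕ.∸ r) (λ k → ∣ a k * a (n ℕ.∸ k) ∣))
            (λ n → a (n ℕ.∸ r)))

-- x_n ≈ Σ_{k ≥ 0} c_k f_k(n):  for every r, x_n = Σ_{k=0}^{r} c_k f_k(n) + O(f_{r+1}(n)),
-- and f_{k+1}(n) = o(f_k(n)) for every k.
Approx : (ℕ → ℚ) → (ℕ → ℚ) → (ℕ → ℕ → ℚ) → Set
Approx x c f =
  ((r : ℕ) → BigO (λ n → x n - sumℚ r (λ k → c k * f k n)) (f (suc r)))
  × ((k : ℕ) → LittleO (f (suc k)) (f k))

-- Probability that a uniform object of SEQ(𝓑) of size p n has exactly m SEQ-irreducible parts:
-- 𝔟^{(m)}_{pn} / 𝔞_{pn}.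
probParts : (ℕ → ℕ) → ℕ → ℕ → ℕ → ℚ
probParts b p m n = ratio (bpow b m (p ℕ.* n)) (seqCount b (p ℕ.* n))

dCoef : (ℕ → ℕ) → ℕ → ℕ → ℕ → ℚ
dCoef b p m k = fromℤ (+ m ℤ.* ((+ bpow b (m ℕ.∸ 1) (p ℕ.* k) ℤ.- + 2 ℤ.* + bpow b m (p ℕ.* k))
                                ℤ.+ + bpow b (suc m) (p ℕ.* k)))

term : (ℕ → ℕ) → ℕ → ℕ → ℕ → ℚ
term b p k n = ℕtoℚ ((p ℕ.* n) C (p ℕ.* k)) * ratio (seqCount b (p ℕ.* (n ℕ.∸ k))) (seqCount b (p ℕ.* n))

-- expansion 1 - Σ_{k≥1} (2 𝔟_{pk} - 𝔟^{(2)}_{pk}) f_k(n), written as Σ_{k≥0} c_k g_k(n)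
-- with c_0 = 1, g_0(n) = 1, and c_k = -(2 𝔟_{pk} - 𝔟^{(2)}_{pk}), g_k = f_k for k ≥ 1.
irrCoef : (ℕ → ℕ) → ℕ → ℕ → ℚ
irrCoef b p zero    = 1ℚ
irrCoef b p (suc k) = - fromℤ (+ 2 ℤ.* + b (p ℕ.* suc k) ℤ.- + bpow b 2 (p ℕ.* suc k))

irrTerm : (ℕ → ℕ) → ℕ → ℕ → ℕ → ℚ
irrTerm b p zero    n = 1ℚ
irrTerm b p (suc k) n = term b p (suc k) n

module Submission where

-- Divide by factorials: with α n = 𝔞_{pn}/(pn)!, β n = 𝔟_{pn}/(pn)! and power m n = 𝔟^{(m)}_{pn}/(pn)!,
-- labeled products become convolutions, power (m+1) = β ⋆ power m and α = δ + β ⋆ α; periodicity lets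
-- the convolutions run over multiples of p only. Say that s has the expansion c when
-- s n - Σ_{k≤r} c k α (n-k) = O(α (n-r-1)) for every r. Splitting a convolution into its r+1 first terms,
-- its r+1 last terms and a central sum, which is O(α (n-r-1)) because α is gargantuan, shows that
-- expansions multiply: s ⋆ t has the expansion s ⋆ e + c ⋆ t. Applied to α ⋆ β = α - δ this determines
-- the expansion of β, with coefficients (δ - β) ⋆ (δ - β), and induction on m then gives power m the
-- coefficients m (power (m-1) - 2 power m + power (m+1)). Multiplying by (pn)!/𝔞_{pn} turns α (n-k) into
-- (pk)! times the k-th term of the statement, and α (n-1) = o(α n) makes consecutive terms decrease.

open import Defs
open import Data.Bool using (true; false)
open import Data.Empty using (⊥-elim)
import Data.Integer as ℤ
import Data.Integer.Properties as ℤP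
import Data.Integer.Tactic.RingSolver as ℤ-Solver
open import Data.Nat as ℕ using (ℕ; zero; suc; _∸_; _⊔_; z≤n; s≤s; _!)
open import Data.Nat.Combinatorics using (_C_; nCn≡1; nCk≡n!/k![n-k]!; k![n∸k]!∣n!)
open import Data.Nat.Divisibility using (_∣_; ∣m+n∣m⇒∣n; ∣⇒≤; m∣m*n)
open import Data.Nat.DivMod using (m/n*n≡m)
open import Data.Nat.Induction using (<-rec)
import Data.Nat.Properties as ℕP
open import Algebra.Properties.CommutativeSemigroup ℕP.+-commutativeSemigroup
  using () renaming (interchange to +-interchange)
open import Data.Product using (_×_; _,_; proj₁; proj₂; ∃-syntax)
open import Data.Rational using (ℚ; 0ℚ; 1ℚ; _+_; _*_; _-_; -_; ∣_∣; _≤_; _<_; positive; nonNegative; toℚᵘ)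
import Data.Rational.Properties as ℚP
open import Data.Rational.Unnormalised as ℚᵘ using (mkℚᵘ; *≡*) renaming (_≃_ to _≃ᵘ_)
import Data.Rational.Unnormalised.Properties as ℚᵘP
open import Data.Sum using (inj₁; inj₂)
open import Relation.Binary.PropositionalEquality
open import Relation.Nullary using (¬_)
open import Relation.Nullary.Decidable using (dec⇒maybe)
open import Tactic.RingSolver using (solve-∀)
open import Tactic.RingSolver.Core.AlmostCommutativeRing using (AlmostCommutativeRing; fromCommutativeRing)

cong₃ : ∀ {A : Set} (f : A → A → A → A) {x x′ y y′ z z′} → x ≡ x′ → y ≡ y′ → z ≡ z′ → f x y z ≡ f x′ y′ z′
cong₃ f refl refl refl = refl

ℚ-ring : AlmostCommutativeRing _ _
ℚ-ring = fromCommutativeRing ℚP.+-*-commutativeRing (λ x → dec⇒maybe (0ℚ ℚP.≟ x))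

p≤∣p∣ : ∀ p → p ≤ ∣ p ∣
p≤∣p∣ p with ℚP.≤-total 0ℚ p
... | inj₁ 0≤p = ℚP.≤-reflexive (sym (ℚP.0≤p⇒∣p∣≡p 0≤p))
... | inj₂ p≤0 = ℚP.≤-trans p≤0 (ℚP.0≤∣p∣ p)

∣*∣-mono : ∀ a b c d → ∣ a ∣ ≤ ∣ c ∣ → ∣ b ∣ ≤ ∣ d ∣ → ∣ a * b ∣ ≤ ∣ c * d ∣
∣*∣-mono a b c d ∣a∣≤∣c∣ ∣b∣≤∣d∣ = begin
  ∣ a * b ∣      ≡⟨ ℚP.∣p*q∣≡∣p∣*∣q∣ a b ⟩
  ∣ a ∣ * ∣ b ∣  ≤⟨ ℚP.*-monoʳ-≤-nonNeg ∣ b ∣ {{ℚP.∣-∣-nonNeg b}} ∣a∣≤∣c∣ ⟩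
  ∣ c ∣ * ∣ b ∣  ≤⟨ ℚP.*-monoˡ-≤-nonNeg ∣ c ∣ {{ℚP.∣-∣-nonNeg c}} ∣b∣≤∣d∣ ⟩
  ∣ c ∣ * ∣ d ∣  ≡⟨ ℚP.∣p*q∣≡∣p∣*∣q∣ c d ⟨
  ∣ c * d ∣      ∎
  where open ℚP.≤-Reasoning

sumℚ-cong : ∀ n {f g : ℕ → ℚ} → (∀ i → i ℕ.≤ n → f i ≡ g i) → sumℚ n f ≡ sumℚ n g
sumℚ-cong zero    f≡g = f≡g 0 z≤n
sumℚ-cong (suc n) f≡g =
  cong₂ _+_ (sumℚ-cong n (λ i i≤n → f≡g i (ℕP.m≤n⇒m≤1+n i≤n))) (f≡g (suc n) ℕP.≤-refl)

sumℚ-+ : ∀ n (f g : ℕ → ℚ) → sumℚ n (λ i → f i + g i) ≡ sumℚ n f + sumℚ n g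
sumℚ-+ zero    f g = refl
sumℚ-+ (suc n) f g = trans (cong (_+ (f (suc n) + g (suc n))) (sumℚ-+ n f g))
                           (interchange (sumℚ n f) (sumℚ n g) (f (suc n)) (g (suc n)))
  where
  interchange : ∀ a b c d → (a + b) + (c + d) ≡ (a + c) + (b + d)
  interchange = solve-∀ ℚ-ring

sumℚ-*ˡ : ∀ n c (f : ℕ → ℚ) → sumℚ n (λ i → c * f i) ≡ c * sumℚ n f
sumℚ-*ˡ zero    c f = refl
sumℚ-*ˡ (suc n) c f = trans (cong (_+ (c * f (suc n))) (sumℚ-*ˡ n c f))
                            (sym (ℚP.*-distribˡ-+ c (sumℚ n f) (f (suc n))))

sumℚ-*ʳ : ∀ n c (f : ℕ → ℚ) → sumℚ n (λ i → f i * c) ≡ sumℚ n f * c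
sumℚ-*ʳ n c f = trans (sumℚ-cong n (λ i _ → ℚP.*-comm (f i) c))
                      (trans (sumℚ-*ˡ n c f) (ℚP.*-comm c (sumℚ n f)))

sumℚ-neg : ∀ n (f : ℕ → ℚ) → sumℚ n (λ i → - f i) ≡ - sumℚ n f
sumℚ-neg zero    f = refl
sumℚ-neg (suc n) f = trans (cong (_+ (- f (suc n))) (sumℚ-neg n f))
                           (sym (ℚP.neg-distrib-+ (sumℚ n f) (f (suc n))))

sumℚ-- : ∀ n (f g : ℕ → ℚ) → sumℚ n (λ i → f i - g i) ≡ sumℚ n f - sumℚ n g
sumℚ-- n f g = trans (sumℚ-+ n f (λ i → - g i)) (cong (sumℚ n f +_) (sumℚ-neg n g))

sumℚ-zero : ∀ n → sumℚ n (λ _ → 0ℚ) ≡ 0ℚ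
sumℚ-zero zero    = refl
sumℚ-zero (suc n) = cong (_+ 0ℚ) (sumℚ-zero n)

sumℚ-suc : ∀ n (f : ℕ → ℚ) → sumℚ (suc n) f ≡ f 0 + sumℚ n (λ i → f (suc i))
sumℚ-suc zero    f = refl
sumℚ-suc (suc n) f = trans (cong (_+ f (suc (suc n))) (sumℚ-suc n f))
                           (ℚP.+-assoc (f 0) (sumℚ n (λ i → f (suc i))) (f (suc (suc n))))

sumℚ-reverse : ∀ n (f : ℕ → ℚ) → sumℚ n f ≡ sumℚ n (λ i → f (n ∸ i))
sumℚ-reverse zero    f = refl
sumℚ-reverse (suc n) f = begin
  sumℚ n f + f (suc n)                       ≡⟨ cong (_+ f (suc n)) (sumℚ-reverse n f) ⟩
  sumℚ n (λ i → f (n ∸ i)) + f (suc n)       ≡⟨ ℚP.+-comm _ (f (suc n)) ⟩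
  f (suc n) + sumℚ n (λ i → f (n ∸ i))       ≡⟨ sumℚ-suc n (λ i → f (suc n ∸ i)) ⟨
  sumℚ (suc n) (λ i → f (suc n ∸ i))         ∎
  where open ≡-Reasoning

sumℚ-append : ∀ r k (f : ℕ → ℚ) →
  sumℚ (suc r ℕ.+ k) f ≡ sumℚ k f + sumℚ r (λ i → f (suc r ℕ.+ k ∸ i))
sumℚ-append zero    k f = refl
sumℚ-append (suc r) k f = begin
  sumℚ (suc r ℕ.+ k) f + f n                       ≡⟨ cong (_+ f n) (sumℚ-append r k f) ⟩
  (sumℚ k f + sumℚ r (λ i → f (n ∸ suc i))) + f n  ≡⟨ ℚP.+-assoc (sumℚ k f) _ (f n) ⟩
  sumℚ k f + (sumℚ r (λ i → f (n ∸ suc i)) + f n)  ≡⟨ cong (sumℚ k f +_) (ℚP.+-comm _ (f n)) ⟩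
  sumℚ k f + (f n + sumℚ r (λ i → f (n ∸ suc i)))  ≡⟨ cong (sumℚ k f +_) (sumℚ-suc r (λ i → f (n ∸ i))) ⟨
  sumℚ k f + sumℚ (suc r) (λ i → f (n ∸ i))        ∎
  where
  open ≡-Reasoning
  n = suc (suc r) ℕ.+ k

sumℚ-triangle : ∀ r (G : ℕ → ℕ → ℚ) →
  sumℚ r (λ j → sumℚ (r ∸ j) (G j)) ≡ sumℚ r (λ i → sumℚ i (λ j → G j (i ∸ j)))
sumℚ-triangle zero    G = refl
sumℚ-triangle (suc r) G = begin
  sumℚ r (λ j → sumℚ (suc r ∸ j) (G j)) + sumℚ (r ∸ r) (G (suc r))
    ≡⟨ cong₂ _+_ (sumℚ-cong r (λ j j≤r → cong (λ m → sumℚ m (G j)) (ℕP.+-∸-assoc 1 j≤r)))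
                 (cong (λ m → sumℚ m (G (suc r))) (ℕP.n∸n≡0 r)) ⟩
  sumℚ r (λ j → sumℚ (r ∸ j) (G j) + G j (suc (r ∸ j))) + G (suc r) 0
    ≡⟨ cong (_+ G (suc r) 0) (sumℚ-+ r _ _) ⟩
  (sumℚ r (λ j → sumℚ (r ∸ j) (G j)) + sumℚ r (λ j → G j (suc (r ∸ j)))) + G (suc r) 0
    ≡⟨ ℚP.+-assoc (sumℚ r (λ j → sumℚ (r ∸ j) (G j))) _ _ ⟩
  sumℚ r (λ j → sumℚ (r ∸ j) (G j)) + (sumℚ r (λ j → G j (suc (r ∸ j))) + G (suc r) 0)
    ≡⟨ cong₂ _+_ (sumℚ-triangle r G)
         (cong₂ _+_ (sumℚ-cong r (λ j j≤r → cong (G j) (sym (ℕP.+-∸-assoc 1 j≤r))))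
                    (cong (G (suc r)) (sym (ℕP.n∸n≡0 r)))) ⟩
  sumℚ r (λ i → sumℚ i (λ j → G j (i ∸ j))) + sumℚ (suc r) (λ j → G j (suc r ∸ j))
    ∎
  where open ≡-Reasoning

sumℚFromTo-suc : ∀ l h (f : ℕ → ℚ) → l ℕ.≤ suc h →
  sumℚFromTo l (suc h) f ≡ sumℚFromTo l h f + f (suc h)
sumℚFromTo-suc l h f l≤1+h with l ℕ.≤ᵇ suc h | ℕP.≤⇒≤ᵇ l≤1+h
... | true  | _  = refl
... | false | ()

sumℚFromTo-empty : ∀ h (f : ℕ → ℚ) → sumℚFromTo (suc (suc h)) (suc h) f ≡ 0ℚ
sumℚFromTo-empty h f with suc (suc h) ℕ.≤ᵇ suc h | ℕP.≤ᵇ⇒≤ (suc (suc h)) (suc h)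
... | true  | 2+h≤1+h = ⊥-elim (ℕP.n≮n (suc h) (2+h≤1+h _))
... | false | _       = refl

sumℚ-split : ∀ l h (f : ℕ → ℚ) → l ℕ.≤ h → sumℚ l f + sumℚFromTo (suc l) h f ≡ sumℚ h f
sumℚ-split zero zero    f z≤n = ℚP.+-identityʳ (f 0)
sumℚ-split l    (suc h) f l≤1+h with ℕP.m≤n⇒m<n∨m≡n l≤1+h
... | inj₂ refl = trans (cong (sumℚ (suc h) f +_) (sumℚFromTo-empty h f)) (ℚP.+-identityʳ _)
... | inj₁ (s≤s l≤h) = begin
  sumℚ l f + sumℚFromTo (suc l) (suc h) f         ≡⟨ cong (sumℚ l f +_) (sumℚFromTo-suc (suc l) h f (s≤s l≤h)) ⟩
  sumℚ l f + (sumℚFromTo (suc l) h f + f (suc h)) ≡⟨ ℚP.+-assoc (sumℚ l f) _ (f (suc h)) ⟨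
  (sumℚ l f + sumℚFromTo (suc l) h f) + f (suc h) ≡⟨ cong (_+ f (suc h)) (sumℚ-split l h f l≤h) ⟩
  sumℚ h f + f (suc h)                            ∎
  where open ≡-Reasoning

sumℚFromTo-mono : ∀ l h (f g : ℕ → ℚ) → (∀ i → f i ≤ g i) → sumℚFromTo l h f ≤ sumℚFromTo l h g
sumℚFromTo-mono zero    zero    f g f≤g = f≤g 0
sumℚFromTo-mono (suc l) zero    f g f≤g = ℚP.≤-refl
sumℚFromTo-mono l       (suc h) f g f≤g with l ℕ.≤ᵇ suc h
... | true  = ℚP.+-mono-≤ (sumℚFromTo-mono l h f g f≤g) (f≤g (suc h))
... | false = ℚP.≤-refl

∣sumℚFromTo∣≤ : ∀ l h (f : ℕ → ℚ) → ∣ sumℚFromTo l h f ∣ ≤ sumℚFromTo l h (λ i → ∣ f i ∣)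
∣sumℚFromTo∣≤ zero    zero    f = ℚP.≤-refl
∣sumℚFromTo∣≤ (suc l) zero    f = ℚP.≤-refl
∣sumℚFromTo∣≤ l       (suc h) f with l ℕ.≤ᵇ suc h
... | true  = ℚP.≤-trans (ℚP.∣p+q∣≤∣p∣+∣q∣ (sumℚFromTo l h f) (f (suc h)))
                         (ℚP.+-monoˡ-≤ _ (∣sumℚFromTo∣≤ l h f))
... | false = ℚP.≤-refl

-- Convolution of sequences

δ : ℕ → ℚ
δ zero    = 1ℚ
δ (suc _) = 0ℚ

infixl 7 _⋆_

_⋆_ : (ℕ → ℚ) → (ℕ → ℚ) → ℕ → ℚ
(f ⋆ g) n = sumℚ n (λ j → f j * g (n ∸ j))

sumℚ-δ : ∀ r (g : ℕ → ℚ) → sumℚ r (λ l → δ l * g l) ≡ g 0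
sumℚ-δ zero    g = ℚP.*-identityˡ (g 0)
sumℚ-δ (suc r) g = begin
  sumℚ r (λ l → δ l * g l) + 0ℚ * g (suc r) ≡⟨ cong₂ _+_ (sumℚ-δ r g) (ℚP.*-zeroˡ (g (suc r))) ⟩
  g 0 + 0ℚ                                  ≡⟨ ℚP.+-identityʳ (g 0) ⟩
  g 0                                       ∎
  where open ≡-Reasoning

⋆-congˡ : ∀ {f f′ : ℕ → ℚ} g → (∀ j → f j ≡ f′ j) → ∀ n → (f ⋆ g) n ≡ (f′ ⋆ g) n
⋆-congˡ g f≡f′ n = sumℚ-cong n (λ j _ → cong (_* g (n ∸ j)) (f≡f′ j))

⋆-congʳ : ∀ f {g g′ : ℕ → ℚ} → (∀ j → g j ≡ g′ j) → ∀ n → (f ⋆ g) n ≡ (f ⋆ g′) n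
⋆-congʳ f g≡g′ n = sumℚ-cong n (λ j _ → cong (f j *_) (g≡g′ (n ∸ j)))

⋆-comm : ∀ f g n → (f ⋆ g) n ≡ (g ⋆ f) n
⋆-comm f g n = trans (sumℚ-reverse n _) (sumℚ-cong n (λ j j≤n →
  trans (cong (λ i → f (n ∸ j) * g i) (ℕP.m∸[m∸n]≡n j≤n)) (ℚP.*-comm (f (n ∸ j)) (g j))))

⋆-identityˡ : ∀ g n → (δ ⋆ g) n ≡ g n
⋆-identityˡ g n = sumℚ-δ n (λ j → g (n ∸ j))

⋆-+ˡ : ∀ f f′ g n → ((λ j → f j + f′ j) ⋆ g) n ≡ (f ⋆ g) n + (f′ ⋆ g) n
⋆-+ˡ f f′ g n = trans (sumℚ-cong n (λ j _ → ℚP.*-distribʳ-+ (g (n ∸ j)) (f j) (f′ j))) (sumℚ-+ n _ _)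

⋆-negˡ : ∀ f g n → ((λ j → - f j) ⋆ g) n ≡ - (f ⋆ g) n
⋆-negˡ f g n = trans (sumℚ-cong n (λ j _ → sym (ℚP.neg-distribˡ-* (f j) (g (n ∸ j))))) (sumℚ-neg n _)

⋆-*ʳ : ∀ c f g n → (f ⋆ (λ j → c * g j)) n ≡ c * (f ⋆ g) n
⋆-*ʳ c f g n = trans (sumℚ-cong n (λ j _ → swap (f j) c (g (n ∸ j)))) (sumℚ-*ˡ n c _)
  where
  swap : ∀ a b d → a * (b * d) ≡ b * (a * d)
  swap = solve-∀ ℚ-ring

⋆--ʳ : ∀ f g g′ n → (f ⋆ (λ j → g j - g′ j)) n ≡ (f ⋆ g) n - (f ⋆ g′) n
⋆--ʳ f g g′ n = trans (sumℚ-cong n (λ j _ → distrib (f j) (g (n ∸ j)) (g′ (n ∸ j)))) (sumℚ-- n _ _)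
  where
  distrib : ∀ a b d → a * (b - d) ≡ a * b - a * d
  distrib = solve-∀ ℚ-ring

∸-∸-cancel : ∀ n {i l} → i ℕ.≤ l → n ∸ i ∸ (l ∸ i) ≡ n ∸ l
∸-∸-cancel n {i} {l} i≤l = trans (ℕP.∸-+-assoc n i (l ∸ i)) (cong (n ∸_) (ℕP.m+[n∸m]≡n i≤l))

⋆-assoc : ∀ f g h n → (f ⋆ (g ⋆ h)) n ≡ ((f ⋆ g) ⋆ h) n
⋆-assoc f g h n = begin
  sumℚ n (λ i → f i * sumℚ (n ∸ i) (λ j → g j * h (n ∸ i ∸ j)))
    ≡⟨ sumℚ-cong n (λ i _ → sym (sumℚ-*ˡ (n ∸ i) (f i) _)) ⟩
  sumℚ n (λ i → sumℚ (n ∸ i) (λ j → f i * (g j * h (n ∸ i ∸ j))))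
    ≡⟨ sumℚ-triangle n (λ i j → f i * (g j * h (n ∸ i ∸ j))) ⟩
  sumℚ n (λ l → sumℚ l (λ i → f i * (g (l ∸ i) * h (n ∸ i ∸ (l ∸ i)))))
    ≡⟨ sumℚ-cong n (λ l _ → trans (sumℚ-cong l (λ i i≤l → regroup i l i≤l)) (sumℚ-*ʳ l (h (n ∸ l)) _)) ⟩
  sumℚ n (λ l → (f ⋆ g) l * h (n ∸ l))
    ∎
  where
  open ≡-Reasoning
  regroup : ∀ i l → i ℕ.≤ l → f i * (g (l ∸ i) * h (n ∸ i ∸ (l ∸ i))) ≡ f i * g (l ∸ i) * h (n ∸ l)
  regroup i l i≤l = trans (sym (ℚP.*-assoc (f i) (g (l ∸ i)) _))
                          (cong (λ m → f i * g (l ∸ i) * h m) (∸-∸-cancel n i≤l))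

O-cong : ∀ {x y f g : ℕ → ℚ} (M : ℕ) → (∀ n → M ℕ.≤ n → x n ≡ y n) → (∀ n → M ℕ.≤ n → f n ≡ g n) →
         BigO x f → BigO y g
O-cong M x≡y f≡g (κ , N , bound) = κ , M ⊔ N , λ n M⊔N≤n →
  subst₂ (λ u v → ∣ u ∣ ≤ κ * ∣ v ∣) (x≡y n (ℕP.m⊔n≤o⇒m≤o M N M⊔N≤n))
                                    (f≡g n (ℕP.m⊔n≤o⇒m≤o M N M⊔N≤n))
         (bound n (ℕP.m⊔n≤o⇒n≤o M N M⊔N≤n))

O-dom : ∀ {x y f : ℕ → ℚ} (M : ℕ) → (∀ n → M ℕ.≤ n → ∣ x n ∣ ≤ ∣ y n ∣) → BigO y f → BigO x f
O-dom M ∣x∣≤∣y∣ (κ , N , bound) = κ , M ⊔ N , λ n M⊔N≤n →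
  ℚP.≤-trans (∣x∣≤∣y∣ n (ℕP.m⊔n≤o⇒m≤o M N M⊔N≤n)) (bound n (ℕP.m⊔n≤o⇒n≤o M N M⊔N≤n))

O-+ : ∀ {x y f : ℕ → ℚ} → BigO x f → BigO y f → BigO (λ n → x n + y n) f
O-+ {x} {y} {f} (κ₁ , N₁ , bound₁) (κ₂ , N₂ , bound₂) = κ₁ + κ₂ , N₁ ⊔ N₂ , λ n N≤n → begin
  ∣ x n + y n ∣                  ≤⟨ ℚP.∣p+q∣≤∣p∣+∣q∣ (x n) (y n) ⟩
  ∣ x n ∣ + ∣ y n ∣              ≤⟨ ℚP.+-mono-≤ (bound₁ n (ℕP.m⊔n≤o⇒m≤o N₁ N₂ N≤n))
                                                (bound₂ n (ℕP.m⊔n≤o⇒n≤o N₁ N₂ N≤n)) ⟩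
  κ₁ * ∣ f n ∣ + κ₂ * ∣ f n ∣    ≡⟨ ℚP.*-distribʳ-+ (∣ f n ∣) κ₁ κ₂ ⟨
  (κ₁ + κ₂) * ∣ f n ∣            ∎
  where open ℚP.≤-Reasoning

O-zero : ∀ {f : ℕ → ℚ} → BigO (λ _ → 0ℚ) f
O-zero {f} = 0ℚ , 0 , λ n _ → ℚP.≤-reflexive (sym (ℚP.*-zeroˡ ∣ f n ∣))

O-neg : ∀ {x f : ℕ → ℚ} → BigO x f → BigO (λ n → - x n) f
O-neg {x} (κ , N , bound) = κ , N , λ n N≤n → subst (_≤ _) (sym (ℚP.∣-p∣≡∣p∣ (x n))) (bound n N≤n)

O-scale : ∀ {x f : ℕ → ℚ} (c : ℚ) → BigO x f → BigO (λ n → c * x n) f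
O-scale {x} {f} c (κ , N , bound) = ∣ c ∣ * κ , N , λ n N≤n → begin
  ∣ c * x n ∣            ≡⟨ ℚP.∣p*q∣≡∣p∣*∣q∣ c (x n) ⟩
  ∣ c ∣ * ∣ x n ∣        ≤⟨ ℚP.*-monoˡ-≤-nonNeg ∣ c ∣ {{ℚP.∣-∣-nonNeg c}} (bound n N≤n) ⟩
  ∣ c ∣ * (κ * ∣ f n ∣)  ≡⟨ ℚP.*-assoc (∣ c ∣) κ (∣ f n ∣) ⟨
  ∣ c ∣ * κ * ∣ f n ∣    ∎
  where open ℚP.≤-Reasoning

O-absorb : ∀ {x f : ℕ → ℚ} (c : ℚ) → BigO x (λ n → c * f n) → BigO x f
O-absorb {x} {f} c (κ , N , bound) = κ * ∣ c ∣ , N , λ n N≤n → begin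
  ∣ x n ∣              ≤⟨ bound n N≤n ⟩
  κ * ∣ c * f n ∣      ≡⟨ cong (κ *_) (ℚP.∣p*q∣≡∣p∣*∣q∣ c (f n)) ⟩
  κ * (∣ c ∣ * ∣ f n ∣) ≡⟨ ℚP.*-assoc κ (∣ c ∣) (∣ f n ∣) ⟨
  κ * ∣ c ∣ * ∣ f n ∣  ∎
  where open ℚP.≤-Reasoning

O-mul : ∀ {x f : ℕ → ℚ} (h : ℕ → ℚ) → BigO x f → BigO (λ n → x n * h n) (λ n → f n * h n)
O-mul {x} {f} h (κ , N , bound) = κ , N , λ n N≤n → begin
  ∣ x n * h n ∣           ≡⟨ ℚP.∣p*q∣≡∣p∣*∣q∣ (x n) (h n) ⟩
  ∣ x n ∣ * ∣ h n ∣       ≤⟨ ℚP.*-monoʳ-≤-nonNeg ∣ h n ∣ {{ℚP.∣-∣-nonNeg (h n)}} (bound n N≤n) ⟩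
  κ * ∣ f n ∣ * ∣ h n ∣   ≡⟨ ℚP.*-assoc κ (∣ f n ∣) (∣ h n ∣) ⟩
  κ * (∣ f n ∣ * ∣ h n ∣) ≡⟨ cong (κ *_) (ℚP.∣p*q∣≡∣p∣*∣q∣ (f n) (h n)) ⟨
  κ * ∣ f n * h n ∣       ∎
  where open ℚP.≤-Reasoning

O-shift : ∀ {x f : ℕ → ℚ} (j : ℕ) → BigO x f → BigO (λ n → x (n ∸ j)) (λ n → f (n ∸ j))
O-shift j (κ , N , bound) = κ , N ℕ.+ j , λ n N+j≤n →
  bound (n ∸ j) (subst (ℕ._≤ n ∸ j) (ℕP.m+n∸n≡m N j) (ℕP.∸-monoˡ-≤ j N+j≤n))

O-sum : ∀ {f : ℕ → ℚ} r (x : ℕ → ℕ → ℚ) → (∀ j → j ℕ.≤ r → BigO (x j) f) →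
        BigO (λ n → sumℚ r (λ j → x j n)) f
O-sum zero    x bounds = bounds 0 z≤n
O-sum (suc r) x bounds = O-+ (O-sum r x (λ j j≤r → bounds j (ℕP.m≤n⇒m≤1+n j≤r))) (bounds (suc r) ℕP.≤-refl)

o-cong : ∀ {x y f g : ℕ → ℚ} (M : ℕ) → (∀ n → M ℕ.≤ n → x n ≡ y n) → (∀ n → M ℕ.≤ n → f n ≡ g n) →
         LittleO x f → LittleO y g
o-cong M x≡y f≡g small ε ε>0 with small ε ε>0
... | N , bound = M ⊔ N , λ n M⊔N≤n →
  subst₂ (λ u v → ∣ u ∣ ≤ ε * ∣ v ∣) (x≡y n (ℕP.m⊔n≤o⇒m≤o M N M⊔N≤n))
                                    (f≡g n (ℕP.m⊔n≤o⇒m≤o M N M⊔N≤n))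
         (bound n (ℕP.m⊔n≤o⇒n≤o M N M⊔N≤n))

o-shift : ∀ {x f : ℕ → ℚ} (j : ℕ) → LittleO x f → LittleO (λ n → x (n ∸ j)) (λ n → f (n ∸ j))
o-shift j small ε ε>0 with small ε ε>0
... | N , bound = N ℕ.+ j , λ n N+j≤n →
  bound (n ∸ j) (subst (ℕ._≤ n ∸ j) (ℕP.m+n∸n≡m N j) (ℕP.∸-monoˡ-≤ j N+j≤n))

o-mul : ∀ {x f : ℕ → ℚ} (h : ℕ → ℚ) → LittleO x f → LittleO (λ n → x n * h n) (λ n → f n * h n)
o-mul h small ε ε>0 with small ε ε>0
... | N , bound = N , λ n N≤n → proj₂ (proj₂ (O-mul h (ε , N , bound))) n N≤n

0<*0< : ∀ {a b} → 0ℚ < a → 0ℚ < b → 0ℚ < a * b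
0<*0< {a} {b} a>0 b>0 =
  ℚP.positive⁻¹ (a * b) {{ℚP.pos*pos⇒pos a {{positive a>0}} b {{positive b>0}}}}

o-rescale : ∀ {x f : ℕ → ℚ} (a b A : ℚ) → 0ℚ ≤ a → 0ℚ < b → 0ℚ < A → A * a ≡ 1ℚ →
            LittleO x f → LittleO (λ n → a * x n) (λ n → b * f n)
o-rescale {x} {f} a b A a≥0 b>0 A>0 Aa≡1 small ε ε>0
  with small (ε * b * A) (0<*0< (0<*0< ε>0 b>0) A>0)
... | N , bound = N , λ n N≤n → begin
  ∣ a * x n ∣                    ≡⟨ trans (ℚP.∣p*q∣≡∣p∣*∣q∣ a (x n)) (cong (_* ∣ x n ∣) (ℚP.0≤p⇒∣p∣≡p a≥0)) ⟩
  a * ∣ x n ∣                    ≤⟨ ℚP.*-monoˡ-≤-nonNeg a {{nonNegative a≥0}} (bound n N≤n) ⟩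
  a * (ε * b * A * ∣ f n ∣)      ≡⟨ regroup a ε b A ∣ f n ∣ ⟩
  A * a * (ε * (b * ∣ f n ∣))    ≡⟨ trans (cong (_* (ε * (b * ∣ f n ∣))) Aa≡1) (ℚP.*-identityˡ _) ⟩
  ε * (b * ∣ f n ∣)              ≡⟨ cong (λ c → ε * (c * ∣ f n ∣)) (ℚP.0≤p⇒∣p∣≡p (ℚP.<⇒≤ b>0)) ⟨
  ε * (∣ b ∣ * ∣ f n ∣)          ≡⟨ cong (ε *_) (ℚP.∣p*q∣≡∣p∣*∣q∣ b (f n)) ⟨
  ε * ∣ b * f n ∣                ∎
  where
  open ℚP.≤-Reasoning
  regroup : ∀ a ε b A F → a * (ε * b * A * F) ≡ A * a * (ε * (b * F))
  regroup = solve-∀ ℚ-ring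

-- Expansions along a gargantuan sequence

sumℚ-split-ends : ∀ r k (F : ℕ → ℚ) → r ℕ.≤ k →
  sumℚ (suc r ℕ.+ k) F ≡ (sumℚ r F + sumℚFromTo (suc r) k F) + sumℚ r (λ i → F (suc r ℕ.+ k ∸ i))
sumℚ-split-ends r k F r≤k =
  trans (sumℚ-append r k F) (cong (_+ sumℚ r (λ i → F (suc r ℕ.+ k ∸ i))) (sym (sumℚ-split r k F r≤k)))

eventually-beyond : ∀ r {P : ℕ → Set} → (∀ k → r ℕ.≤ k → P (suc r ℕ.+ k)) → ∀ n → suc r ℕ.+ r ℕ.≤ n → P n
eventually-beyond r {P} P-beyond n 2r+1≤n =
  subst P (ℕP.m+[n∸m]≡n (ℕP.m+n≤o⇒m≤o (suc r) 2r+1≤n))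
        (P-beyond (n ∸ suc r) (subst (ℕ._≤ n ∸ suc r) (ℕP.m+n∸m≡n (suc r) r) (ℕP.∸-monoˡ-≤ (suc r) 2r+1≤n)))

∸-suc-∸ : ∀ n {j r} → j ℕ.≤ r → n ∸ j ∸ suc (r ∸ j) ≡ n ∸ suc r
∸-suc-∸ n {j} {r} j≤r =
  trans (cong (n ∸ j ∸_) (sym (ℕP.+-∸-assoc 1 j≤r))) (∸-∸-cancel n (ℕP.m≤n⇒m≤1+n j≤r))

module Expansions (α : ℕ → ℚ) where

  remainder : (ℕ → ℚ) → (ℕ → ℚ) → ℕ → ℕ → ℚ
  remainder s c r n = s n - sumℚ r (λ k → c k * α (n ∸ k))

  RemainderBound : (ℕ → ℚ) → (ℕ → ℚ) → ℕ → Set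
  RemainderBound s c r = BigO (remainder s c r) (λ n → α (n ∸ suc r))

  HasExpansion : (ℕ → ℚ) → (ℕ → ℚ) → Set
  HasExpansion s c = ∀ r → RemainderBound s c r

  Dominated : (ℕ → ℚ) → Set
  Dominated s = ∀ j → ∣ s j ∣ ≤ ∣ α j ∣

  weightedRemainders : (ℕ → ℚ) → (ℕ → ℚ) → (ℕ → ℚ) → ℕ → ℕ → ℚ
  weightedRemainders u v c r n = sumℚ r (λ j → u j * remainder v c (r ∸ j) (n ∸ j))

  centralSum : (ℕ → ℚ) → (ℕ → ℚ) → ℕ → ℕ → ℚ
  centralSum s t r n = sumℚFromTo (suc r) (n ∸ suc r) (λ j → s j * t (n ∸ j))

  HasExpansion-cong : ∀ {s s′ c c′} → (∀ n → s n ≡ s′ n) → (∀ k → c k ≡ c′ k) →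
                      HasExpansion s c → HasExpansion s′ c′
  HasExpansion-cong {s} {s′} {c} {c′} s≡s′ c≡c′ expansion r =
    O-cong 0 (λ n _ → cong₂ _-_ (s≡s′ n) (sumℚ-cong r (λ k _ → cong (_* α (n ∸ k)) (c≡c′ k))))
             (λ _ _ → refl) (expansion r)

  δ-expansion : HasExpansion δ (λ _ → 0ℚ)
  δ-expansion r = O-cong 1 vanishes (λ _ _ → refl) O-zero
    where
    vanishes : ∀ n → 1 ℕ.≤ n → 0ℚ ≡ remainder δ (λ _ → 0ℚ) r n
    vanishes (suc n) _ = sym (cong (λ z → 0ℚ - z)
                                   (trans (sumℚ-cong r (λ k _ → ℚP.*-zeroˡ (α (suc n ∸ k)))) (sumℚ-zero r)))

  remainder-α-δ : ∀ r n → remainder α δ r n ≡ 0ℚ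
  remainder-α-δ r n = trans (cong (λ z → α n - z) (sumℚ-δ r (λ k → α (n ∸ k)))) (ℚP.+-inverseʳ (α n))

  truncated-⋆ : ∀ r n (u v c : ℕ → ℚ) →
    sumℚ r (λ j → u j * v (n ∸ j)) ≡ weightedRemainders u v c r n + sumℚ r (λ l → (u ⋆ c) l * α (n ∸ l))
  truncated-⋆ r n u v c = begin
    sumℚ r (λ j → u j * v (n ∸ j))
      ≡⟨ sumℚ-cong r (λ j _ → split (u j) (v (n ∸ j)) (S j)) ⟩
    sumℚ r (λ j → u j * remainder v c (r ∸ j) (n ∸ j) + u j * S j)
      ≡⟨ sumℚ-+ r _ _ ⟩
    weightedRemainders u v c r n + sumℚ r (λ j → u j * S j)
      ≡⟨ cong (weightedRemainders u v c r n +_) (sumℚ-cong r (λ j _ → sym (sumℚ-*ˡ (r ∸ j) (u j) _))) ⟩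
    weightedRemainders u v c r n + sumℚ r (λ j → sumℚ (r ∸ j) (λ k → u j * (c k * α (n ∸ j ∸ k))))
      ≡⟨ cong (weightedRemainders u v c r n +_) (sumℚ-triangle r (λ j k → u j * (c k * α (n ∸ j ∸ k)))) ⟩
    weightedRemainders u v c r n + sumℚ r (λ l → sumℚ l (λ j → u j * (c (l ∸ j) * α (n ∸ j ∸ (l ∸ j)))))
      ≡⟨ cong (weightedRemainders u v c r n +_) (sumℚ-cong r (λ l _ →
           trans (sumℚ-cong l (λ j j≤l → regroup j l j≤l)) (sumℚ-*ʳ l (α (n ∸ l)) _))) ⟩
    weightedRemainders u v c r n + sumℚ r (λ l → (u ⋆ c) l * α (n ∸ l))
      ∎
    where
    open ≡-Reasoning
    S : ℕ → ℚ
    S j = sumℚ (r ∸ j) (λ k → c k * α (n ∸ j ∸ k))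
    split : ∀ a b d → a * b ≡ a * (b - d) + a * d
    split = solve-∀ ℚ-ring
    regroup : ∀ j l → j ℕ.≤ l → u j * (c (l ∸ j) * α (n ∸ j ∸ (l ∸ j))) ≡ u j * c (l ∸ j) * α (n ∸ l)
    regroup j l j≤l = trans (sym (ℚP.*-assoc (u j) (c (l ∸ j)) _))
                            (cong (λ m → u j * c (l ∸ j) * α m) (∸-∸-cancel n j≤l))

  -- In (s ⋆ t) n, expand t in the first r+1 terms and s in the last r+1; what is left over is the
  -- central sum and the remainders of s and t.
  product-remainder : ∀ r k (s t c e : ℕ → ℚ) → r ℕ.≤ k →
    remainder (s ⋆ t) (λ l → (s ⋆ e) l + (c ⋆ t) l) r (suc r ℕ.+ k)
      ≡ (weightedRemainders s t e r (suc r ℕ.+ k) + centralSum s t r (suc r ℕ.+ k))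
        + weightedRemainders t s c r (suc r ℕ.+ k)
  product-remainder r k s t c e r≤k = begin
    (s ⋆ t) n - sumℚ r (λ l → ((s ⋆ e) l + (c ⋆ t) l) * α (n ∸ l))
      ≡⟨ cong₂ _-_ (sumℚ-split-ends r k F r≤k)
                   (trans (sumℚ-cong r (λ l _ → ℚP.*-distribʳ-+ (α (n ∸ l)) ((s ⋆ e) l) ((c ⋆ t) l)))
                          (sumℚ-+ r _ _)) ⟩
    ((sumℚ r F + sumℚFromTo (suc r) k F) + sumℚ r (λ i → F (n ∸ i))) - (T₁ + T₂)
      ≡⟨ cong (_- (T₁ + T₂)) (cong₂ _+_ (cong₂ _+_ (truncated-⋆ r n s t e) central) reflected) ⟩
    ((W₁ + T₁) + M + (W₂ + T₂)) - (T₁ + T₂)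
      ≡⟨ cancel W₁ T₁ M W₂ T₂ ⟩
    (W₁ + M) + W₂
      ∎
    where
    open ≡-Reasoning
    n = suc r ℕ.+ k
    F : ℕ → ℚ
    F j = s j * t (n ∸ j)
    T₁ T₂ W₁ W₂ M : ℚ
    T₁ = sumℚ r (λ l → (s ⋆ e) l * α (n ∸ l))
    T₂ = sumℚ r (λ l → (c ⋆ t) l * α (n ∸ l))
    W₁ = weightedRemainders s t e r n
    W₂ = weightedRemainders t s c r n
    M = centralSum s t r n
    cancel : ∀ a b c d e → ((a + b) + c + (d + e)) - (b + e) ≡ (a + c) + d
    cancel = solve-∀ ℚ-ring
    central : sumℚFromTo (suc r) k F ≡ M
    central = cong (λ m → sumℚFromTo (suc r) m F) (sym (ℕP.m+n∸m≡n (suc r) k))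
    reflected : sumℚ r (λ i → F (n ∸ i)) ≡ W₂ + T₂
    reflected = begin
      sumℚ r (λ i → F (n ∸ i))
        ≡⟨ sumℚ-cong r (λ i i≤r → trans (cong (λ m → s (n ∸ i) * t m) (ℕP.m∸[m∸n]≡n (i≤n i≤r)))
                                        (ℚP.*-comm (s (n ∸ i)) (t i))) ⟩
      sumℚ r (λ i → t i * s (n ∸ i))
        ≡⟨ truncated-⋆ r n t s c ⟩
      W₂ + sumℚ r (λ l → (t ⋆ c) l * α (n ∸ l))
        ≡⟨ cong (W₂ +_) (sumℚ-cong r (λ l _ → cong (_* α (n ∸ l)) (⋆-comm t c l))) ⟩
      W₂ + T₂
        ∎
      where
      i≤n : ∀ {i} → i ℕ.≤ r → i ℕ.≤ n
      i≤n i≤r = ℕP.≤-trans i≤r (ℕP.≤-trans r≤k (ℕP.m≤n+m k (suc r)))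

  weightedRemainders-O : ∀ r u v c → HasExpansion v c →
                         BigO (weightedRemainders u v c r) (λ n → α (n ∸ suc r))
  weightedRemainders-O r u v c expansion = O-sum r _ (λ j j≤r →
    O-scale (u j) (O-cong 0 (λ _ _ → refl) (λ n _ → cong α (∸-suc-∸ n j≤r)) (O-shift j (expansion (r ∸ j)))))

  -- The case s = α, t = β of the product identity: its left side vanishes since α ⋆ (δ - β) = δ, so it
  -- expresses the r-th remainder of β through the lower ones.
  module Renewal (β c : ℕ → ℚ) (α₀≡1 : α 0 ≡ 1ℚ) (renewal : ∀ n → 1 ℕ.≤ n → α n ≡ (β ⋆ α) n)
                 (α⋆c≡δ-β : ∀ l → (α ⋆ c) l ≡ δ l - β l) where

    lower : ℕ → ℕ → ℚ
    lower zero    n = 0ℚ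
    lower (suc r) n = sumℚ r (λ i → α (suc i) * remainder β c (r ∸ i) (n ∸ suc i))

    lower-O : ∀ r → (∀ {r′} → r′ ℕ.< r → RemainderBound β c r′) → BigO (lower r) (λ n → α (n ∸ suc r))
    lower-O zero    _     = O-zero
    lower-O (suc r) below = O-sum r _ (λ i i≤r →
      O-scale (α (suc i)) (O-cong 0 (λ _ _ → refl) (λ n _ → cong α (∸-suc-∸ n (s≤s i≤r)))
                                    (O-shift (suc i) (below (s≤s (ℕP.m∸n≤m r i))))))

    α₀*remainder : ∀ r n → α 0 * remainder β c r n ≡ remainder β c r n
    α₀*remainder r n = trans (cong (_* remainder β c r n) α₀≡1) (ℚP.*-identityˡ (remainder β c r n))

    weightedRemainders-peel : ∀ r n → weightedRemainders α β c r n ≡ remainder β c r n + lower r n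
    weightedRemainders-peel zero    n = trans (α₀*remainder 0 n) (sym (ℚP.+-identityʳ (remainder β c 0 n)))
    weightedRemainders-peel (suc r) n = trans (sumℚ-suc r (λ j → α j * remainder β c (suc r ∸ j) (n ∸ j)))
                                              (cong (_+ lower (suc r) n) (α₀*remainder (suc r) n))

    renewal-remainder : ∀ r k → r ℕ.≤ k →
      remainder (α ⋆ β) (λ l → (α ⋆ c) l + (δ ⋆ β) l) r (suc r ℕ.+ k) ≡ 0ℚ
    renewal-remainder r k r≤k = begin
      (α ⋆ β) n - sumℚ r (λ l → ((α ⋆ c) l + (δ ⋆ β) l) * α (n ∸ l))
        ≡⟨ cong₂ _-_ (trans (⋆-comm α β n) (sym (renewal n (s≤s z≤n))))
                     (trans (sumℚ-cong r (λ l _ → cong (_* α (n ∸ l)) (coefficients l)))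
                            (sumℚ-δ r (λ l → α (n ∸ l)))) ⟩
      α n - α n
        ≡⟨ ℚP.+-inverseʳ (α n) ⟩
      0ℚ
        ∎
      where
      open ≡-Reasoning
      n = suc r ℕ.+ k
      sub-add : ∀ a b → a - b + b ≡ a
      sub-add = solve-∀ ℚ-ring
      coefficients : ∀ l → (α ⋆ c) l + (δ ⋆ β) l ≡ δ l
      coefficients l = trans (cong₂ _+_ (α⋆c≡δ-β l) (⋆-identityˡ β l)) (sub-add (δ l) (β l))

    remainder-recursion : ∀ r k → r ℕ.≤ k →
      remainder β c r (suc r ℕ.+ k) ≡ - (centralSum α β r (suc r ℕ.+ k) + lower r (suc r ℕ.+ k))
    remainder-recursion r k r≤k = isolate (remainder β c r n) (lower r n) (centralSum α β r n) (begin
      (remainder β c r n + lower r n) + centralSum α β r n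
        ≡⟨ cong (_+ centralSum α β r n) (weightedRemainders-peel r n) ⟨
      weightedRemainders α β c r n + centralSum α β r n
        ≡⟨ ℚP.+-identityʳ _ ⟨
      (weightedRemainders α β c r n + centralSum α β r n) + 0ℚ
        ≡⟨ cong ((weightedRemainders α β c r n + centralSum α β r n) +_) no-remainders-of-α ⟨
      (weightedRemainders α β c r n + centralSum α β r n) + weightedRemainders β α δ r n
        ≡⟨ product-remainder r k α β δ c r≤k ⟨
      remainder (α ⋆ β) (λ l → (α ⋆ c) l + (δ ⋆ β) l) r n
        ≡⟨ renewal-remainder r k r≤k ⟩
      0ℚ
        ∎)
      where
      open ≡-Reasoning
      n = suc r ℕ.+ k
      no-remainders-of-α : weightedRemainders β α δ r n ≡ 0ℚ
      no-remainders-of-α = trans (sumℚ-cong r (λ j _ →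
          trans (cong (β j *_) (remainder-α-δ (r ∸ j) (n ∸ j))) (ℚP.*-zeroʳ (β j)))) (sumℚ-zero r)
      isolate : ∀ x h m → (x + h) + m ≡ 0ℚ → x ≡ - (m + h)
      isolate x h m sum≡0 = trans (rearrange x h m) (trans (cong (_- (m + h)) sum≡0) (ℚP.+-identityˡ _))
        where
        rearrange : ∀ x h m → x ≡ ((x + h) + m) - (m + h)
        rearrange = solve-∀ ℚ-ring

  module _ (garg : Gargantuan α) where

    centralSum-O : ∀ r {s t} → Dominated s → Dominated t → BigO (centralSum s t r) (λ n → α (n ∸ suc r))
    centralSum-O r {s} {t} s≼α t≼α = O-dom 0 bound (proj₂ (proj₂ garg) (suc r) (s≤s z≤n))
      where
      bound : ∀ n → 0 ℕ.≤ n →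
              ∣ centralSum s t r n ∣ ≤ ∣ sumℚFromTo (suc r) (n ∸ suc r) (λ j → ∣ α j * α (n ∸ j) ∣) ∣
      bound n _ = begin
        ∣ centralSum s t r n ∣
          ≤⟨ ∣sumℚFromTo∣≤ (suc r) (n ∸ suc r) _ ⟩
        sumℚFromTo (suc r) (n ∸ suc r) (λ j → ∣ s j * t (n ∸ j) ∣)
          ≤⟨ sumℚFromTo-mono (suc r) (n ∸ suc r) _ _
               (λ j → ∣*∣-mono (s j) (t (n ∸ j)) (α j) (α (n ∸ j)) (s≼α j) (t≼α (n ∸ j))) ⟩
        sumℚFromTo (suc r) (n ∸ suc r) (λ j → ∣ α j * α (n ∸ j) ∣)
          ≤⟨ p≤∣p∣ _ ⟩
        ∣ sumℚFromTo (suc r) (n ∸ suc r) (λ j → ∣ α j * α (n ∸ j) ∣) ∣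
          ∎
        where open ℚP.≤-Reasoning

    ⋆-expansion : ∀ {s t c e} → Dominated s → Dominated t → HasExpansion s c → HasExpansion t e →
                  HasExpansion (s ⋆ t) (λ l → (s ⋆ e) l + (c ⋆ t) l)
    ⋆-expansion {s} {t} {c} {e} s≼α t≼α s≈ t≈ r =
      O-cong (suc r ℕ.+ r) (eventually-beyond r (λ k r≤k → sym (product-remainder r k s t c e r≤k)))
             (λ _ _ → refl)
             (O-+ (O-+ (weightedRemainders-O r s t e t≈) (centralSum-O r s≼α t≼α)) (weightedRemainders-O r t s c s≈))

    inverse-expansion : ∀ {β c} → Dominated β → α 0 ≡ 1ℚ → (∀ n → 1 ℕ.≤ n → α n ≡ (β ⋆ α) n) →
                        (∀ l → (α ⋆ c) l ≡ δ l - β l) → HasExpansion β c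
    inverse-expansion {β} {c} β≼α α₀≡1 renewal α⋆c≡δ-β = <-rec _ step
      where
      open Renewal β c α₀≡1 renewal α⋆c≡δ-β
      step : ∀ r → (∀ {r′} → r′ ℕ.< r → RemainderBound β c r′) → RemainderBound β c r
      step r below =
        O-cong (suc r ℕ.+ r) (eventually-beyond r (λ k r≤k → sym (remainder-recursion r k r≤k)))
               (λ _ _ → refl)
               (O-neg (O-+ (centralSum-O r (λ _ → ℚP.≤-refl) β≼α) (lower-O r below)))

-- Both ratio x (suc d) and fromℤ z unfold to fromℚᵘ of an unnormalised fraction, where the ring laws hold
-- up to ≃ᵘ.
toℚᵘ-fromℤ : ∀ z → toℚᵘ (fromℤ z) ≃ᵘ mkℚᵘ z 0
toℚᵘ-fromℤ z = ℚP.toℚᵘ-fromℚᵘ (mkℚᵘ z 0)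

fromℤ-+ : ∀ a b → fromℤ (a ℤ.+ b) ≡ fromℤ a + fromℤ b
fromℤ-+ a b = ℚP.toℚᵘ-injective (begin
  toℚᵘ (fromℤ (a ℤ.+ b))                ≈⟨ toℚᵘ-fromℤ (a ℤ.+ b) ⟩
  mkℚᵘ (a ℤ.+ b) 0                      ≈⟨ *≡* (identity a b) ⟩
  mkℚᵘ a 0 ℚᵘ.+ mkℚᵘ b 0                ≈⟨ ℚᵘP.+-cong (toℚᵘ-fromℤ a) (toℚᵘ-fromℤ b) ⟨
  toℚᵘ (fromℤ a) ℚᵘ.+ toℚᵘ (fromℤ b)    ≈⟨ ℚP.toℚᵘ-homo-+ (fromℤ a) (fromℤ b) ⟨
  toℚᵘ (fromℤ a + fromℤ b)              ∎)
  where
  open ℚᵘP.≃-Reasoning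
  identity : ∀ a b → (a ℤ.+ b) ℤ.* ℤ.+ 1 ≡ (a ℤ.* ℤ.+ 1 ℤ.+ b ℤ.* ℤ.+ 1) ℤ.* ℤ.+ 1
  identity = ℤ-Solver.solve-∀

fromℤ-* : ∀ a b → fromℤ (a ℤ.* b) ≡ fromℤ a * fromℤ b
fromℤ-* a b = ℚP.toℚᵘ-injective (begin
  toℚᵘ (fromℤ (a ℤ.* b))                ≈⟨ toℚᵘ-fromℤ (a ℤ.* b) ⟩
  mkℚᵘ a 0 ℚᵘ.* mkℚᵘ b 0                ≈⟨ ℚᵘP.*-cong (toℚᵘ-fromℤ a) (toℚᵘ-fromℤ b) ⟨
  toℚᵘ (fromℤ a) ℚᵘ.* toℚᵘ (fromℤ b)    ≈⟨ ℚP.toℚᵘ-homo-* (fromℤ a) (fromℤ b) ⟨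
  toℚᵘ (fromℤ a * fromℤ b)              ∎)
  where open ℚᵘP.≃-Reasoning

fromℤ-neg : ∀ a → fromℤ (ℤ.- a) ≡ - fromℤ a
fromℤ-neg a = ℚP.toℚᵘ-injective (begin
  toℚᵘ (fromℤ (ℤ.- a))    ≈⟨ toℚᵘ-fromℤ (ℤ.- a) ⟩
  ℚᵘ.- mkℚᵘ a 0           ≈⟨ ℚᵘP.-‿cong (toℚᵘ-fromℤ a) ⟨
  ℚᵘ.- toℚᵘ (fromℤ a)     ≈⟨ ℚP.toℚᵘ-homo‿- (fromℤ a) ⟨
  toℚᵘ (- fromℤ a)        ∎)
  where open ℚᵘP.≃-Reasoning

fromℤ-- : ∀ a b → fromℤ (a ℤ.- b) ≡ fromℤ a - fromℤ b
fromℤ-- a b = trans (fromℤ-+ a (ℤ.- b)) (cong (fromℤ a +_) (fromℤ-neg b))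

ℕtoℚ-+ : ∀ x y → ℕtoℚ (x ℕ.+ y) ≡ ℕtoℚ x + ℕtoℚ y
ℕtoℚ-+ x y = fromℤ-+ (ℤ.+ x) (ℤ.+ y)

ℕtoℚ-* : ∀ x y → ℕtoℚ (x ℕ.* y) ≡ ℕtoℚ x * ℕtoℚ y
ℕtoℚ-* x y = trans (cong fromℤ (ℤP.pos-* x y)) (fromℤ-* (ℤ.+ x) (ℤ.+ y))

fromℤ-second-difference : ∀ m x y z →
  fromℤ (ℤ.+ m ℤ.* ((ℤ.+ x ℤ.- ℤ.+ 2 ℤ.* ℤ.+ y) ℤ.+ ℤ.+ z))
    ≡ ℕtoℚ m * ((ℕtoℚ x - ℕtoℚ y) - (ℕtoℚ y - ℕtoℚ z))
fromℤ-second-difference m x y z = begin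
  fromℤ (ℤ.+ m ℤ.* ((ℤ.+ x ℤ.- ℤ.+ 2 ℤ.* ℤ.+ y) ℤ.+ ℤ.+ z))
    ≡⟨ cong fromℤ (regroup (ℤ.+ m) (ℤ.+ x) (ℤ.+ y) (ℤ.+ z)) ⟩
  fromℤ (ℤ.+ m ℤ.* ((ℤ.+ x ℤ.- ℤ.+ y) ℤ.- (ℤ.+ y ℤ.- ℤ.+ z)))
    ≡⟨ fromℤ-* (ℤ.+ m) _ ⟩
  ℕtoℚ m * fromℤ ((ℤ.+ x ℤ.- ℤ.+ y) ℤ.- (ℤ.+ y ℤ.- ℤ.+ z))
    ≡⟨ cong (ℕtoℚ m *_) (trans (fromℤ-- (ℤ.+ x ℤ.- ℤ.+ y) (ℤ.+ y ℤ.- ℤ.+ z))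
                                (cong₂ _-_ (fromℤ-- (ℤ.+ x) (ℤ.+ y)) (fromℤ-- (ℤ.+ y) (ℤ.+ z)))) ⟩
  ℕtoℚ m * ((ℕtoℚ x - ℕtoℚ y) - (ℕtoℚ y - ℕtoℚ z))
    ∎
  where
  open ≡-Reasoning
  regroup : ∀ m x y z → m ℤ.* ((x ℤ.- ℤ.+ 2 ℤ.* y) ℤ.+ z) ≡ m ℤ.* ((x ℤ.- y) ℤ.- (y ℤ.- z))
  regroup = ℤ-Solver.solve-∀

ratio-*-denominator : ∀ x d → ¬ d ≡ 0 → ratio x d * ℕtoℚ d ≡ ℕtoℚ x
ratio-*-denominator x zero    d≢0 = ⊥-elim (d≢0 refl)
ratio-*-denominator x (suc d) _   = ℚP.toℚᵘ-injective (begin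
  toℚᵘ (ratio x (suc d) * ℕtoℚ (suc d))             ≈⟨ ℚP.toℚᵘ-homo-* (ratio x (suc d)) (ℕtoℚ (suc d)) ⟩
  toℚᵘ (ratio x (suc d)) ℚᵘ.* toℚᵘ (ℕtoℚ (suc d))   ≈⟨ ℚᵘP.*-cong (ℚP.toℚᵘ-fromℚᵘ (mkℚᵘ (ℤ.+ x) d))
                                                                  (toℚᵘ-fromℤ (ℤ.+ suc d)) ⟩
  mkℚᵘ (ℤ.+ x) d ℚᵘ.* mkℚᵘ (ℤ.+ suc d) 0             ≈⟨ *≡* (identity (ℤ.+ x) (ℤ.+ suc d)) ⟩
  mkℚᵘ (ℤ.+ x) 0                                    ≈⟨ toℚᵘ-fromℤ (ℤ.+ x) ⟨
  toℚᵘ (ℕtoℚ x)                                     ∎)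
  where
  open ℚᵘP.≃-Reasoning
  identity : ∀ a b → (a ℤ.* b) ℤ.* ℤ.+ 1 ≡ a ℤ.* (b ℤ.* ℤ.+ 1)
  identity = ℤ-Solver.solve-∀

*-cancelʳ-ℕtoℚ : ∀ d → ¬ d ≡ 0 → ∀ p q → p * ℕtoℚ d ≡ q * ℕtoℚ d → p ≡ q
*-cancelʳ-ℕtoℚ d d≢0 p q pd≡qd = begin
  p                          ≡⟨ ℚP.*-identityʳ p ⟨
  p * 1ℚ                     ≡⟨ cong (p *_) inverse ⟨
  p * (ℕtoℚ d * ratio 1 d)   ≡⟨ ℚP.*-assoc p (ℕtoℚ d) (ratio 1 d) ⟨
  p * ℕtoℚ d * ratio 1 d     ≡⟨ cong (_* ratio 1 d) pd≡qd ⟩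
  q * ℕtoℚ d * ratio 1 d     ≡⟨ ℚP.*-assoc q (ℕtoℚ d) (ratio 1 d) ⟩
  q * (ℕtoℚ d * ratio 1 d)   ≡⟨ cong (q *_) inverse ⟩
  q * 1ℚ                     ≡⟨ ℚP.*-identityʳ q ⟩
  q                          ∎
  where
  open ≡-Reasoning
  inverse : ℕtoℚ d * ratio 1 d ≡ 1ℚ
  inverse = trans (ℚP.*-comm (ℕtoℚ d) (ratio 1 d)) (ratio-*-denominator 1 d d≢0)

ratio-unique : ∀ x d q → ¬ d ≡ 0 → q * ℕtoℚ d ≡ ℕtoℚ x → ratio x d ≡ q
ratio-unique x d q d≢0 qd≡x = *-cancelʳ-ℕtoℚ d d≢0 _ _ (trans (ratio-*-denominator x d d≢0) (sym qd≡x))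

ratio-+ : ∀ x y d → ¬ d ≡ 0 → ratio (x ℕ.+ y) d ≡ ratio x d + ratio y d
ratio-+ x y d d≢0 = ratio-unique (x ℕ.+ y) d _ d≢0 (begin
  (ratio x d + ratio y d) * ℕtoℚ d               ≡⟨ ℚP.*-distribʳ-+ (ℕtoℚ d) (ratio x d) (ratio y d) ⟩
  ratio x d * ℕtoℚ d + ratio y d * ℕtoℚ d        ≡⟨ cong₂ _+_ (ratio-*-denominator x d d≢0)
                                                              (ratio-*-denominator y d d≢0) ⟩
  ℕtoℚ x + ℕtoℚ y                                ≡⟨ ℕtoℚ-+ x y ⟨
  ℕtoℚ (x ℕ.+ y)                                 ∎)
  where open ≡-Reasoning

ratio-*ˡ : ∀ x y d → ¬ d ≡ 0 → ratio (x ℕ.* y) d ≡ ℕtoℚ x * ratio y d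
ratio-*ˡ x y d d≢0 = ratio-unique (x ℕ.* y) d _ d≢0 (begin
  ℕtoℚ x * ratio y d * ℕtoℚ d     ≡⟨ ℚP.*-assoc (ℕtoℚ x) (ratio y d) (ℕtoℚ d) ⟩
  ℕtoℚ x * (ratio y d * ℕtoℚ d)   ≡⟨ cong (ℕtoℚ x *_) (ratio-*-denominator y d d≢0) ⟩
  ℕtoℚ x * ℕtoℚ y                 ≡⟨ ℕtoℚ-* x y ⟨
  ℕtoℚ (x ℕ.* y)                  ∎)
  where open ≡-Reasoning

ratio-chain : ∀ x N A → ¬ N ≡ 0 → ratio x A ≡ ratio x N * ratio N A
ratio-chain x N zero    _   = sym (ℚP.*-zeroʳ (ratio x N))
ratio-chain x N (suc A) N≢0 = ratio-unique x (suc A) _ (λ ()) (begin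
  ratio x N * ratio N (suc A) * ℕtoℚ (suc A)    ≡⟨ ℚP.*-assoc (ratio x N) (ratio N (suc A)) (ℕtoℚ (suc A)) ⟩
  ratio x N * (ratio N (suc A) * ℕtoℚ (suc A))  ≡⟨ cong (ratio x N *_) (ratio-*-denominator N (suc A) (λ ())) ⟩
  ratio x N * ℕtoℚ N                            ≡⟨ ratio-*-denominator x N N≢0 ⟩
  ℕtoℚ x                                        ∎)
  where open ≡-Reasoning

ratio-self : ∀ A → ¬ A ≡ 0 → ratio A A ≡ 1ℚ
ratio-self A A≢0 = ratio-unique A A 1ℚ A≢0 (ℚP.*-identityˡ (ℕtoℚ A))

ratio-zero : ∀ d → ratio 0 d ≡ 0ℚ
ratio-zero zero    = refl
ratio-zero (suc d) = ℚP.0/n≡0 (suc d)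

ratio-nonNeg : ∀ x d → 0ℚ ≤ ratio x d
ratio-nonNeg x zero    = ℚP.≤-refl
ratio-nonNeg x (suc d) = ℚP.nonNegative⁻¹ _ {{ℚP.normalize-nonNeg x (suc d)}}

ratio-mono : ∀ {x y} d → x ℕ.≤ y → ratio x d ≤ ratio y d
ratio-mono         zero    x≤y = ℚP.≤-refl
ratio-mono {x} {y} (suc d) x≤y = begin
  ratio x (suc d)                               ≡⟨ ℚP.+-identityʳ (ratio x (suc d)) ⟨
  ratio x (suc d) + 0ℚ                          ≤⟨ ℚP.+-monoʳ-≤ (ratio x (suc d)) (ratio-nonNeg (y ∸ x) (suc d)) ⟩
  ratio x (suc d) + ratio (y ∸ x) (suc d)       ≡⟨ ratio-+ x (y ∸ x) (suc d) (λ ()) ⟨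
  ratio (x ℕ.+ (y ∸ x)) (suc d)                 ≡⟨ cong (λ z → ratio z (suc d)) (ℕP.m+[n∸m]≡n x≤y) ⟩
  ratio y (suc d)                               ∎
  where open ℚP.≤-Reasoning

0<ratio-1 : ∀ d → ¬ d ≡ 0 → 0ℚ < ratio 1 d
0<ratio-1 zero    d≢0 = ⊥-elim (d≢0 refl)
0<ratio-1 (suc d) _   = ℚP.positive⁻¹ _ {{ℚP.normalize-pos 1 (suc d)}}

0<ℕtoℚ : ∀ d → ¬ d ≡ 0 → 0ℚ < ℕtoℚ d
0<ℕtoℚ zero    d≢0 = ⊥-elim (d≢0 refl)
0<ℕtoℚ (suc d) _   = ℚP.positive⁻¹ _ {{ℚP.normalize-pos (suc d) 1}}

n!≢0 : ∀ n → ¬ n ! ≡ 0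
n!≢0 n n!≡0 = ℕP.<-irrefl (sym n!≡0) (ℕP.1≤n! n)

binomial-factorials : ∀ {N K} → K ℕ.≤ N → (N C K) ℕ.* (K ! ℕ.* (N ∸ K) !) ≡ N !
binomial-factorials {N} {K} K≤N =
  trans (cong (ℕ._* (K ! ℕ.* (N ∸ K) !)) (nCk≡n!/k![n-k]! K≤N)) (m/n*n≡m {{_}} (k![n∸k]!∣n! K≤N))

ratio-binomial : ∀ N K u v → K ℕ.≤ N →
  ratio ((N C K) ℕ.* u ℕ.* v) (N !) ≡ ratio u (K !) * ratio v ((N ∸ K) !)
ratio-binomial N K u v K≤N = ratio-unique _ (N !) _ (n!≢0 N) (begin
  a * b * ℕtoℚ (N !)
    ≡⟨ cong (λ z → a * b * ℕtoℚ z) (binomial-factorials K≤N) ⟨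
  a * b * ℕtoℚ ((N C K) ℕ.* (K ! ℕ.* (N ∸ K) !))
    ≡⟨ cong (a * b *_) (trans (ℕtoℚ-* (N C K) _) (cong (ℕtoℚ (N C K) *_) (ℕtoℚ-* (K !) ((N ∸ K) !)))) ⟩
  a * b * (ℕtoℚ (N C K) * (ℕtoℚ (K !) * ℕtoℚ ((N ∸ K) !)))
    ≡⟨ regroup a b (ℕtoℚ (N C K)) (ℕtoℚ (K !)) (ℕtoℚ ((N ∸ K) !)) ⟩
  ℕtoℚ (N C K) * (a * ℕtoℚ (K !)) * (b * ℕtoℚ ((N ∸ K) !))
    ≡⟨ cong₂ (λ p q → ℕtoℚ (N C K) * p * q) (ratio-*-denominator u (K !) (n!≢0 K))
                                            (ratio-*-denominator v ((N ∸ K) !) (n!≢0 (N ∸ K))) ⟩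
  ℕtoℚ (N C K) * ℕtoℚ u * ℕtoℚ v
    ≡⟨ trans (ℕtoℚ-* ((N C K) ℕ.* u) v) (cong (_* ℕtoℚ v) (ℕtoℚ-* (N C K) u)) ⟨
  ℕtoℚ ((N C K) ℕ.* u ℕ.* v)
    ∎)
  where
  open ≡-Reasoning
  a = ratio u (K !)
  b = ratio v ((N ∸ K) !)
  regroup : ∀ a b c k l → a * b * (c * (k * l)) ≡ c * (a * k) * (b * l)
  regroup = solve-∀ ℚ-ring

sumℕ-cong : ∀ n {f g : ℕ → ℕ} → (∀ i → i ℕ.≤ n → f i ≡ g i) → sumℕ n f ≡ sumℕ n g
sumℕ-cong zero    f≡g = f≡g 0 z≤n
sumℕ-cong (suc n) f≡g =
  cong₂ ℕ._+_ (sumℕ-cong n (λ i i≤n → f≡g i (ℕP.m≤n⇒m≤1+n i≤n))) (f≡g (suc n) ℕP.≤-refl)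

sumℕ-+ : ∀ n (f g : ℕ → ℕ) → sumℕ n (λ i → f i ℕ.+ g i) ≡ sumℕ n f ℕ.+ sumℕ n g
sumℕ-+ zero    f g = refl
sumℕ-+ (suc n) f g = trans (cong (ℕ._+ (f (suc n) ℕ.+ g (suc n))) (sumℕ-+ n f g))
                           (+-interchange (sumℕ n f) (sumℕ n g) (f (suc n)) (g (suc n)))

sumℕ-*ˡ : ∀ n c (f : ℕ → ℕ) → sumℕ n (λ i → c ℕ.* f i) ≡ c ℕ.* sumℕ n f
sumℕ-*ˡ zero    c f = refl
sumℕ-*ˡ (suc n) c f = trans (cong (ℕ._+ (c ℕ.* f (suc n))) (sumℕ-*ˡ n c f))
                            (sym (ℕP.*-distribˡ-+ c (sumℕ n f) (f (suc n))))

sumℕ-zero : ∀ n (f : ℕ → ℕ) → (∀ i → i ℕ.≤ n → f i ≡ 0) → sumℕ n f ≡ 0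
sumℕ-zero zero    f f≡0 = f≡0 0 z≤n
sumℕ-zero (suc n) f f≡0 =
  cong₂ ℕ._+_ (sumℕ-zero n f (λ i i≤n → f≡0 i (ℕP.m≤n⇒m≤1+n i≤n))) (f≡0 (suc n) ℕP.≤-refl)

sumℕ-last : ∀ n (f : ℕ → ℕ) → (∀ i → i ℕ.< n → f i ≡ 0) → sumℕ n f ≡ f n
sumℕ-last zero    f _   = refl
sumℕ-last (suc n) f f≡0 = cong (ℕ._+ f (suc n)) (sumℕ-zero n f (λ i i≤n → f≡0 i (s≤s i≤n)))

sumℕ-suc : ∀ n (f : ℕ → ℕ) → sumℕ (suc n) f ≡ f 0 ℕ.+ sumℕ n (λ i → f (suc i))
sumℕ-suc zero    f = refl
sumℕ-suc (suc n) f = trans (cong (ℕ._+ f (suc (suc n))) (sumℕ-suc n f)) (ℕP.+-assoc (f 0) _ (f (suc (suc n))))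

sumℕ-comm : ∀ A B (f : ℕ → ℕ → ℕ) →
  sumℕ A (λ m → sumℕ B (λ i → f m i)) ≡ sumℕ B (λ i → sumℕ A (λ m → f m i))
sumℕ-comm zero    B f = refl
sumℕ-comm (suc A) B f = trans (cong (ℕ._+ sumℕ B (f (suc A))) (sumℕ-comm A B f)) (sym (sumℕ-+ B _ _))

sumℕ-truncate : ∀ A B (g : ℕ → ℕ) → A ℕ.≤ B → (∀ m → A ℕ.< m → g m ≡ 0) → sumℕ B g ≡ sumℕ A g
sumℕ-truncate A zero    g z≤n _ = refl
sumℕ-truncate A (suc B) g A≤1+B g≡0 with ℕP.m≤n⇒m<n∨m≡n A≤1+B
... | inj₂ refl = refl
... | inj₁ (s≤s A≤B) =
  trans (cong₂ ℕ._+_ (sumℕ-truncate A B g A≤B g≡0) (g≡0 (suc B) (s≤s A≤B))) (ℕP.+-identityʳ _)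

term≤sumℕ : ∀ n (f : ℕ → ℕ) i → i ℕ.≤ n → f i ℕ.≤ sumℕ n f
term≤sumℕ zero    f .zero z≤n = ℕP.≤-refl
term≤sumℕ (suc n) f i   i≤1+n with ℕP.m≤n⇒m<n∨m≡n i≤1+n
... | inj₂ refl      = ℕP.m≤n+m (f (suc n)) (sumℕ n f)
... | inj₁ (s≤s i≤n) = ℕP.≤-trans (term≤sumℕ n f i i≤n) (ℕP.m≤m+n (sumℕ n f) (f (suc n)))

sumℕ-append : ∀ a c (g : ℕ → ℕ) → sumℕ (a ℕ.+ suc c) g ≡ sumℕ a g ℕ.+ sumℕ c (λ i → g (a ℕ.+ suc i))
sumℕ-append a zero    g rewrite ℕP.+-comm a 1 = refl
sumℕ-append a (suc c) g = begin
  sumℕ (a ℕ.+ suc (suc c)) g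
    ≡⟨ cong (λ m → sumℕ m g) (ℕP.+-suc a (suc c)) ⟩
  sumℕ (a ℕ.+ suc c) g ℕ.+ g (suc (a ℕ.+ suc c))
    ≡⟨ cong₂ ℕ._+_ (sumℕ-append a c g) (cong g (sym (ℕP.+-suc a (suc c)))) ⟩
  (sumℕ a g ℕ.+ sumℕ c (λ i → g (a ℕ.+ suc i))) ℕ.+ g (a ℕ.+ suc (suc c))
    ≡⟨ ℕP.+-assoc (sumℕ a g) _ _ ⟩
  sumℕ a g ℕ.+ sumℕ (suc c) (λ i → g (a ℕ.+ suc i))
    ∎
  where open ≡-Reasoning

ratio-sumℕ : ∀ n (f : ℕ → ℕ) d → ¬ d ≡ 0 → ratio (sumℕ n f) d ≡ sumℚ n (λ i → ratio (f i) d)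
ratio-sumℕ zero    f d _   = refl
ratio-sumℕ (suc n) f d d≢0 =
  trans (ratio-+ (sumℕ n f) (f (suc n)) d d≢0) (cong (_+ ratio (f (suc n)) d) (ratio-sumℕ n f d d≢0))

-- Counting sequences of labeled products and sequences

module Counting (b : ℕ → ℕ) (b₀≡0 : b 0 ≡ 0) where

  bpow-one : ∀ N → bpow b 1 N ≡ b N
  bpow-one N = begin
    sumℕ N (λ j → (N C j) ℕ.* b j ℕ.* bpow b 0 (N ∸ j))
      ≡⟨ sumℕ-last N _ (λ j j<N → trans (cong ((N C j) ℕ.* b j ℕ.*_) (empty (ℕP.m<n⇒0<n∸m j<N)))
                                        (ℕP.*-zeroʳ ((N C j) ℕ.* b j))) ⟩
    (N C N) ℕ.* b N ℕ.* bpow b 0 (N ∸ N)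
      ≡⟨ cong₂ (λ c m → c ℕ.* b N ℕ.* bpow b 0 m) (nCn≡1 N) (ℕP.n∸n≡0 N) ⟩
    1 ℕ.* b N ℕ.* 1
      ≡⟨ trans (ℕP.*-identityʳ (1 ℕ.* b N)) (ℕP.*-identityˡ (b N)) ⟩
    b N
      ∎
    where
    open ≡-Reasoning
    empty : ∀ {M} → 0 ℕ.< M → bpow b 0 M ≡ 0
    empty {suc M} _ = refl

  bpow-vanishes : ∀ m N → N ℕ.< m → bpow b m N ≡ 0
  bpow-vanishes (suc m) N (s≤s N≤m) = sumℕ-zero N _ term≡0
    where
    term≡0 : ∀ j → j ℕ.≤ N → (N C j) ℕ.* b j ℕ.* bpow b m (N ∸ j) ≡ 0
    term≡0 zero    _ = trans (cong (λ z → (N C 0) ℕ.* z ℕ.* bpow b m N) b₀≡0)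
                             (cong (ℕ._* bpow b m N) (ℕP.*-zeroʳ (N C 0)))
    term≡0 (suc j) j<N = trans (cong ((N C suc j) ℕ.* b (suc j) ℕ.*_)
                                     (bpow-vanishes m (N ∸ suc j) (ℕP.<-≤-trans (ℕP.∸-monoʳ-< (s≤s z≤n) j<N) N≤m)))
                               (ℕP.*-zeroʳ ((N C suc j) ℕ.* b (suc j)))

  bpow≤seqCount : ∀ m N → bpow b m N ℕ.≤ seqCount b N
  bpow≤seqCount m N with ℕP.≤-<-connex m N
  ... | inj₁ m≤N = term≤sumℕ N (λ m → bpow b m N) m m≤N
  ... | inj₂ N<m = subst (ℕ._≤ seqCount b N) (sym (bpow-vanishes m N N<m)) z≤n

  seqCount-recurrence : ∀ N →
    seqCount b (suc N) ≡ sumℕ (suc N) (λ i → (suc N C i) ℕ.* b i ℕ.* seqCount b (suc N ∸ i))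
  seqCount-recurrence N = begin
    sumℕ (suc N) (λ m → bpow b m (suc N))
      ≡⟨ sumℕ-suc N (λ m → bpow b m (suc N)) ⟩
    sumℕ N (λ m → sumℕ (suc N) (λ i → (suc N C i) ℕ.* b i ℕ.* bpow b m (suc N ∸ i)))
      ≡⟨ sumℕ-comm N (suc N) (λ m i → (suc N C i) ℕ.* b i ℕ.* bpow b m (suc N ∸ i)) ⟩
    sumℕ (suc N) (λ i → sumℕ N (λ m → (suc N C i) ℕ.* b i ℕ.* bpow b m (suc N ∸ i)))
      ≡⟨ sumℕ-cong (suc N) (λ i _ → trans (sumℕ-*ˡ N ((suc N C i) ℕ.* b i) _) (truncated i)) ⟩
    sumℕ (suc N) (λ i → (suc N C i) ℕ.* b i ℕ.* seqCount b (suc N ∸ i))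
      ∎
    where
    open ≡-Reasoning
    truncated : ∀ i → (suc N C i) ℕ.* b i ℕ.* sumℕ N (λ m → bpow b m (suc N ∸ i))
                    ≡ (suc N C i) ℕ.* b i ℕ.* seqCount b (suc N ∸ i)
    truncated zero    rewrite b₀≡0 | ℕP.*-zeroʳ (suc N C 0) = refl
    truncated (suc i) = cong ((suc N C suc i) ℕ.* b (suc i) ℕ.*_)
      (sumℕ-truncate (N ∸ i) N _ (ℕP.m∸n≤m N i) (λ m N∸i<m → bpow-vanishes m (N ∸ i) N∸i<m))

sumℕ-multiples : ∀ p′ n (g : ℕ → ℕ) → (∀ i → ¬ suc p′ ∣ i → g i ≡ 0) →
                 sumℕ (suc p′ ℕ.* n) g ≡ sumℕ n (λ j → g (suc p′ ℕ.* j))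
sumℕ-multiples p′ zero    g g≡0 = trans (cong (λ m → sumℕ m g) (ℕP.*-zeroʳ p′)) (cong g (sym (ℕP.*-zeroʳ p′)))
sumℕ-multiples p′ (suc n) g g≡0 = begin
  sumℕ (P ℕ.* suc n) g
    ≡⟨ cong (λ m → sumℕ m g) P[1+n]≡Pn+P ⟩
  sumℕ (P ℕ.* n ℕ.+ suc p′) g
    ≡⟨ sumℕ-append (P ℕ.* n) p′ g ⟩
  sumℕ (P ℕ.* n) g ℕ.+ sumℕ p′ (λ i → g (P ℕ.* n ℕ.+ suc i))
    ≡⟨ cong₂ ℕ._+_ (sumℕ-multiples p′ n g g≡0) (sumℕ-last p′ _ (λ i i<p′ → g≡0 _ (off-multiple i<p′))) ⟩
  sumℕ n (λ j → g (P ℕ.* j)) ℕ.+ g (P ℕ.* n ℕ.+ suc p′)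
    ≡⟨ cong (λ m → sumℕ n (λ j → g (P ℕ.* j)) ℕ.+ g m) P[1+n]≡Pn+P ⟨
  sumℕ (suc n) (λ j → g (P ℕ.* j))
    ∎
  where
  open ≡-Reasoning
  P = suc p′
  P[1+n]≡Pn+P : P ℕ.* suc n ≡ P ℕ.* n ℕ.+ P
  P[1+n]≡Pn+P = trans (ℕP.*-suc P n) (ℕP.+-comm P (P ℕ.* n))
  off-multiple : ∀ {i} → i ℕ.< p′ → ¬ P ∣ P ℕ.* n ℕ.+ suc i
  off-multiple i<p′ P∣ = ℕP.<-irrefl refl (ℕP.≤-trans (s≤s i<p′) (∣⇒≤ (∣m+n∣m⇒∣n P∣ (m∣m*n n))))

module Normalised (b : ℕ → ℕ) (b₀≡0 : b 0 ≡ 0) (p′ : ℕ) (periodic : Periodic (suc p′) (seqCount b)) where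
  open Counting b b₀≡0

  P : ℕ
  P = suc p′

  normalise : (ℕ → ℕ) → ℕ → ℚ
  normalise h n = ratio (h (P ℕ.* n)) ((P ℕ.* n) !)

  b-vanishes : ∀ i → ¬ P ∣ i → b i ≡ 0
  b-vanishes i P∤i = ℕP.n≤0⇒n≡0 (subst (b i ℕ.≤_) (proj₂ periodic i P∤i)
                                       (subst (ℕ._≤ seqCount b i) (bpow-one i) (bpow≤seqCount 1 i)))

  normalise-convolution : ∀ (h : ℕ → ℕ) n →
    ratio (sumℕ (P ℕ.* n) (λ i → ((P ℕ.* n) C i) ℕ.* b i ℕ.* h (P ℕ.* n ∸ i))) ((P ℕ.* n) !)
      ≡ (normalise b ⋆ normalise h) n
  normalise-convolution h n = begin
    ratio (sumℕ (P ℕ.* n) G) ((P ℕ.* n) !)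
      ≡⟨ cong (λ z → ratio z ((P ℕ.* n) !)) (sumℕ-multiples p′ n G G-vanishes) ⟩
    ratio (sumℕ n (λ j → G (P ℕ.* j))) ((P ℕ.* n) !)
      ≡⟨ ratio-sumℕ n (λ j → G (P ℕ.* j)) ((P ℕ.* n) !) (n!≢0 (P ℕ.* n)) ⟩
    sumℚ n (λ j → ratio (G (P ℕ.* j)) ((P ℕ.* n) !))
      ≡⟨ sumℚ-cong n (λ j j≤n → trans (ratio-binomial (P ℕ.* n) (P ℕ.* j) _ _ (ℕP.*-monoʳ-≤ P j≤n))
           (cong (λ z → normalise b j * ratio (h z) (z !)) (sym (ℕP.*-distribˡ-∸ P n j)))) ⟩
    (normalise b ⋆ normalise h) n
      ∎
    where
    open ≡-Reasoning
    G : ℕ → ℕ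
    G i = ((P ℕ.* n) C i) ℕ.* b i ℕ.* h (P ℕ.* n ∸ i)
    G-vanishes : ∀ i → ¬ P ∣ i → G i ≡ 0
    G-vanishes i P∤i rewrite b-vanishes i P∤i | ℕP.*-zeroʳ ((P ℕ.* n) C i) = refl

-- Normalised counting sequences and their expansions

module Asymptotics (b : ℕ → ℕ) (b₀≡0 : b 0 ≡ 0) (p′ : ℕ) (periodic : Periodic (suc p′) (seqCount b))
                   (garg : Gargantuan (λ n → ratio (seqCount b (suc p′ ℕ.* n)) ((suc p′ ℕ.* n) !))) where
  open Counting b b₀≡0
  open Normalised b b₀≡0 p′ periodic

  α β : ℕ → ℚ
  α = normalise (seqCount b)
  β = normalise b

  power : ℕ → ℕ → ℚ
  power m = normalise (bpow b m)

  open Expansions α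

  α₀≡1 : α 0 ≡ 1ℚ
  α₀≡1 = cong (λ z → ratio (seqCount b z) (z !)) (ℕP.*-zeroʳ P)

  power-zero : ∀ n → power 0 n ≡ δ n
  power-zero zero    = cong (λ z → ratio (bpow b 0 z) (z !)) (ℕP.*-zeroʳ P)
  power-zero (suc n) = ratio-zero ((P ℕ.* suc n) !)

  power-suc : ∀ m n → power (suc m) n ≡ (β ⋆ power m) n
  power-suc m = normalise-convolution (bpow b m)

  power-one : ∀ n → power 1 n ≡ β n
  power-one n = cong (λ z → ratio z ((P ℕ.* n) !)) (bpow-one (P ℕ.* n))

  renewal : ∀ n → 1 ℕ.≤ n → α n ≡ (β ⋆ α) n
  renewal (suc n) _ = trans (cong (λ z → ratio z ((P ℕ.* suc n) !)) (seqCount-recurrence (n ℕ.+ p′ ℕ.* suc n)))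
                            (normalise-convolution (seqCount b) (suc n))

  power-dominated : ∀ m → Dominated (power m)
  power-dominated m n = subst₂ _≤_ (sym (ℚP.0≤p⇒∣p∣≡p (ratio-nonNeg (bpow b m (P ℕ.* n)) ((P ℕ.* n) !))))
                                   (sym (ℚP.0≤p⇒∣p∣≡p (ratio-nonNeg (seqCount b (P ℕ.* n)) ((P ℕ.* n) !))))
                               (ratio-mono ((P ℕ.* n) !) (bpow≤seqCount m (P ℕ.* n)))

  β-dominated : Dominated β
  β-dominated n = subst (λ z → ∣ z ∣ ≤ ∣ α n ∣) (power-one n) (power-dominated 1 n)

  γ : ℕ → ℚ
  γ j = δ j - β j

  γ⋆ : ∀ x n → (γ ⋆ x) n ≡ x n - (β ⋆ x) n
  γ⋆ x n = trans (⋆-+ˡ δ (λ j → - β j) x n) (cong₂ _+_ (⋆-identityˡ x n) (⋆-negˡ β x n))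

  α⋆γ : ∀ n → (α ⋆ γ) n ≡ δ n
  α⋆γ n = trans (⋆-comm α γ n) (trans (γ⋆ α n) (α-β⋆α n))
    where
    α-β⋆α : ∀ n → α n - (β ⋆ α) n ≡ δ n
    α-β⋆α zero    = trans (cong (λ z → α 0 - z * α 0) β₀≡0)
                          (trans (cong (λ z → α 0 - z) (ℚP.*-zeroˡ (α 0))) (trans (ℚP.+-identityʳ (α 0)) α₀≡1))
      where
      β₀≡0 : β 0 ≡ 0ℚ
      β₀≡0 = trans (cong (λ z → ratio (b z) (z !)) (ℕP.*-zeroʳ P)) (cong (λ z → ratio z 1) b₀≡0)
    α-β⋆α (suc n) = trans (cong (λ z → α (suc n) - z) (sym (renewal (suc n) (s≤s z≤n)))) (ℚP.+-inverseʳ (α (suc n)))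

  c : ℕ → ℚ
  c = γ ⋆ γ

  α⋆c : ∀ l → (α ⋆ c) l ≡ δ l - β l
  α⋆c l = trans (⋆-assoc α γ γ l) (trans (⋆-congˡ γ α⋆γ l) (⋆-identityˡ γ l))

  β-expansion : HasExpansion β c
  β-expansion = inverse-expansion garg {β} {c} β-dominated α₀≡1 renewal α⋆c

  gap : ℕ → ℕ → ℚ
  gap m n = power m n - power (suc m) n

  coefficient : ℕ → ℕ → ℚ
  coefficient m k = ℕtoℚ m * ((power (m ∸ 1) k - power m k) - gap m k)

  β⋆gap : ∀ m n → (β ⋆ gap m) n ≡ gap (suc m) n
  β⋆gap m n = trans (⋆--ʳ β (power m) (power (suc m)) n)
                    (sym (cong₂ _-_ (power-suc m n) (power-suc (suc m) n)))

  c⋆power : ∀ m n → (c ⋆ power m) n ≡ gap m n - gap (suc m) n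
  c⋆power m n = begin
    ((γ ⋆ γ) ⋆ power m) n  ≡⟨ ⋆-assoc γ γ (power m) n ⟨
    (γ ⋆ (γ ⋆ power m)) n  ≡⟨ ⋆-congʳ γ γ⋆power n ⟩
    (γ ⋆ gap m) n          ≡⟨ γ⋆ (gap m) n ⟩
    gap m n - (β ⋆ gap m) n ≡⟨ cong (λ z → gap m n - z) (β⋆gap m n) ⟩
    gap m n - gap (suc m) n ∎
    where
    open ≡-Reasoning
    γ⋆power : ∀ j → (γ ⋆ power m) j ≡ gap m j
    γ⋆power j = trans (γ⋆ (power m) j) (cong (λ z → power m j - z) (sym (power-suc m j)))

  β⋆coefficient : ∀ m n → (β ⋆ coefficient m) n ≡ ℕtoℚ m * (gap m n - gap (suc m) n)
  β⋆coefficient zero    n = trans (⋆-*ʳ 0ℚ β (λ k → (power 0 k - power 0 k) - gap 0 k) n)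
    (trans (ℚP.*-zeroˡ ((β ⋆ (λ k → (power 0 k - power 0 k) - gap 0 k)) n)) (sym (ℚP.*-zeroˡ (gap 0 n - gap 1 n))))
  β⋆coefficient (suc m) n = trans (⋆-*ʳ (ℕtoℚ (suc m)) β (λ k → gap m k - gap (suc m) k) n)
    (cong (ℕtoℚ (suc m) *_) (trans (⋆--ʳ β (gap m) (gap (suc m)) n)
                                   (cong₂ _-_ (β⋆gap m n) (β⋆gap (suc m) n))))

  coefficient-suc : ∀ m l → (β ⋆ coefficient m) l + (c ⋆ power m) l ≡ coefficient (suc m) l
  coefficient-suc m l = begin
    (β ⋆ coefficient m) l + (c ⋆ power m) l  ≡⟨ cong₂ _+_ (β⋆coefficient m l) (c⋆power m l) ⟩
    ℕtoℚ m * g + g                           ≡⟨ collect (ℕtoℚ m) g ⟩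
    (1ℚ + ℕtoℚ m) * g                        ≡⟨ cong (_* g) (ℕtoℚ-+ 1 m) ⟨
    coefficient (suc m) l                    ∎
    where
    open ≡-Reasoning
    g = gap m l - gap (suc m) l
    collect : ∀ x y → x * y + y ≡ (1ℚ + x) * y
    collect = solve-∀ ℚ-ring

  power-expansion : ∀ m → HasExpansion (power m) (coefficient m)
  power-expansion zero    = HasExpansion-cong (λ n → sym (power-zero n))
                                              (λ k → sym (ℚP.*-zeroˡ ((power 0 k - power 0 k) - gap 0 k)))
                                              δ-expansion
  power-expansion (suc m) = HasExpansion-cong (λ n → sym (power-suc m n)) (coefficient-suc m)
    (⋆-expansion garg {β} {power m} {c} {coefficient m} β-dominated (power-dominated m) β-expansion (power-expansion m))

  ι w W : ℕ → ℚ
  ι n = ratio ((P ℕ.* n) !) (seqCount b (P ℕ.* n))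
  w k = ratio 1 ((P ℕ.* k) !)
  W k = ℕtoℚ ((P ℕ.* k) !)

  W*w≡1 : ∀ k → W k * w k ≡ 1ℚ
  W*w≡1 k = trans (ℚP.*-comm (W k) (w k)) (ratio-*-denominator 1 ((P ℕ.* k) !) (n!≢0 (P ℕ.* k)))

  probParts≡ : ∀ m n → probParts b P m n ≡ power m n * ι n
  probParts≡ m n = ratio-chain (bpow b m (P ℕ.* n)) ((P ℕ.* n) !) (seqCount b (P ℕ.* n)) (n!≢0 (P ℕ.* n))

  term≡ : ∀ k n → k ℕ.≤ n → term b P k n ≡ w k * (α (n ∸ k) * ι n)
  term≡ k n k≤n = begin
    ℕtoℚ Cnk * ratio A (seqCount b (P ℕ.* n))
      ≡⟨ cong (ℕtoℚ Cnk *_) (ratio-chain A ((P ℕ.* n) !) (seqCount b (P ℕ.* n)) (n!≢0 (P ℕ.* n))) ⟩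
    ℕtoℚ Cnk * (ratio A ((P ℕ.* n) !) * ι n)
      ≡⟨ ℚP.*-assoc (ℕtoℚ Cnk) (ratio A ((P ℕ.* n) !)) (ι n) ⟨
    ℕtoℚ Cnk * ratio A ((P ℕ.* n) !) * ι n
      ≡⟨ cong (_* ι n) (ratio-*ˡ Cnk A ((P ℕ.* n) !) (n!≢0 (P ℕ.* n))) ⟨
    ratio (Cnk ℕ.* A) ((P ℕ.* n) !) * ι n
      ≡⟨ cong (λ z → ratio (z ℕ.* A) ((P ℕ.* n) !) * ι n) (ℕP.*-identityʳ Cnk) ⟨
    ratio (Cnk ℕ.* 1 ℕ.* A) ((P ℕ.* n) !) * ι n
      ≡⟨ cong (_* ι n) (ratio-binomial (P ℕ.* n) (P ℕ.* k) 1 A (ℕP.*-monoʳ-≤ P k≤n)) ⟩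
    w k * ratio A ((P ℕ.* n ∸ P ℕ.* k) !) * ι n
      ≡⟨ cong (λ z → w k * ratio A (z !) * ι n) (ℕP.*-distribˡ-∸ P n k) ⟨
    w k * α (n ∸ k) * ι n
      ≡⟨ ℚP.*-assoc (w k) (α (n ∸ k)) (ι n) ⟩
    w k * (α (n ∸ k) * ι n)
      ∎
    where
    open ≡-Reasoning
    Cnk = (P ℕ.* n) C (P ℕ.* k)
    A = seqCount b (P ℕ.* (n ∸ k))

  power≡ : ∀ j k → power j k ≡ ℕtoℚ (bpow b j (P ℕ.* k)) * w k
  power≡ j k = trans (cong (λ z → ratio z ((P ℕ.* k) !)) (sym (ℕP.*-identityʳ (bpow b j (P ℕ.* k)))))
                     (ratio-*ˡ (bpow b j (P ℕ.* k)) 1 ((P ℕ.* k) !) (n!≢0 (P ℕ.* k)))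

  coefficient≡ : ∀ m k → coefficient m k ≡ dCoef b P m k * w k
  coefficient≡ m k = begin
    ℕtoℚ m * ((power (m ∸ 1) k - power m k) - (power m k - power (suc m) k))
      ≡⟨ cong₃ (λ x y z → ℕtoℚ m * ((x - y) - (y - z))) (power≡ (m ∸ 1) k) (power≡ m k) (power≡ (suc m) k) ⟩
    ℕtoℚ m * ((X * w k - Y * w k) - (Y * w k - Z * w k))
      ≡⟨ factor (ℕtoℚ m) X Y Z (w k) ⟩
    ℕtoℚ m * ((X - Y) - (Y - Z)) * w k
      ≡⟨ cong (_* w k) (fromℤ-second-difference m (bpow b (m ∸ 1) (P ℕ.* k)) (bpow b m (P ℕ.* k))
                                                              (bpow b (suc m) (P ℕ.* k))) ⟨
    dCoef b P m k * w k
      ∎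
    where
    open ≡-Reasoning
    X Y Z : ℚ
    X = ℕtoℚ (bpow b (m ∸ 1) (P ℕ.* k))
    Y = ℕtoℚ (bpow b m (P ℕ.* k))
    Z = ℕtoℚ (bpow b (suc m) (P ℕ.* k))
    factor : ∀ m x y z u → m * ((x * u - y * u) - (y * u - z * u)) ≡ m * ((x - y) - (y - z)) * u
    factor = solve-∀ ℚ-ring

  probParts-expansion : ∀ m r →
    BigO (λ n → probParts b P m n - sumℚ r (λ k → dCoef b P m k * term b P k n)) (term b P (suc r))
  probParts-expansion m r =
    O-absorb (W (suc r)) (O-cong (suc r) remainder≡ bound≡ (O-mul ι (power-expansion m r)))
    where
    remainder≡ : ∀ n → suc r ℕ.≤ n →
      remainder (power m) (coefficient m) r n * ι n ≡ probParts b P m n - sumℚ r (λ k → dCoef b P m k * term b P k n)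
    remainder≡ n r<n = begin
      (power m n - sumℚ r (λ k → coefficient m k * α (n ∸ k))) * ι n
        ≡⟨ distrib (power m n) (sumℚ r (λ k → coefficient m k * α (n ∸ k))) (ι n) ⟩
      power m n * ι n - sumℚ r (λ k → coefficient m k * α (n ∸ k)) * ι n
        ≡⟨ cong₂ _-_ (probParts≡ m n) (sumℚ-*ʳ r (ι n) (λ k → coefficient m k * α (n ∸ k))) ⟨
      probParts b P m n - sumℚ r (λ k → coefficient m k * α (n ∸ k) * ι n)
        ≡⟨ cong (λ z → probParts b P m n - z) (sumℚ-cong r (λ k k≤r → trans
             (cong (λ z → z * α (n ∸ k) * ι n) (coefficient≡ m k))
             (trans (regroup (dCoef b P m k) (w k) (α (n ∸ k)) (ι n))
                    (cong (dCoef b P m k *_) (sym (term≡ k n (ℕP.≤-trans k≤r (ℕP.<⇒≤ r<n)))))))) ⟩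
      probParts b P m n - sumℚ r (λ k → dCoef b P m k * term b P k n)
        ∎
      where
      open ≡-Reasoning
      distrib : ∀ x s i → (x - s) * i ≡ x * i - s * i
      distrib = solve-∀ ℚ-ring
      regroup : ∀ d u a i → d * u * a * i ≡ d * (u * (a * i))
      regroup = solve-∀ ℚ-ring
    bound≡ : ∀ n → suc r ℕ.≤ n → α (n ∸ suc r) * ι n ≡ W (suc r) * term b P (suc r) n
    bound≡ n r<n = sym (begin
      W (suc r) * term b P (suc r) n                   ≡⟨ cong (W (suc r) *_) (term≡ (suc r) n r<n) ⟩
      W (suc r) * (w (suc r) * (α (n ∸ suc r) * ι n))  ≡⟨ ℚP.*-assoc (W (suc r)) (w (suc r)) _ ⟨
      W (suc r) * w (suc r) * (α (n ∸ suc r) * ι n)    ≡⟨ cong (_* (α (n ∸ suc r) * ι n)) (W*w≡1 (suc r)) ⟩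
      1ℚ * (α (n ∸ suc r) * ι n)                       ≡⟨ ℚP.*-identityˡ _ ⟩
      α (n ∸ suc r) * ι n                              ∎)
      where open ≡-Reasoning

  term-decreasing : ∀ k → LittleO (term b P (suc k)) (term b P k)
  term-decreasing k =
    o-cong (suc k) (λ n k<n → trans (cong (λ i → w (suc k) * (α i * ι n)) (∸-suc k n)) (sym (term≡ (suc k) n k<n)))
                   (λ n k<n → sym (term≡ k n (ℕP.<⇒≤ k<n)))
      (o-rescale (w (suc k)) (w k) (W (suc k))
                 (ratio-nonNeg 1 ((P ℕ.* suc k) !)) (0<ratio-1 ((P ℕ.* k) !) (n!≢0 (P ℕ.* k)))
                 (0<ℕtoℚ ((P ℕ.* suc k) !) (n!≢0 (P ℕ.* suc k))) (W*w≡1 (suc k))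
                 (o-mul ι (o-shift k (proj₁ (proj₂ garg)))))
    where
    ∸-suc : ∀ k n → n ∸ k ∸ 1 ≡ n ∸ suc k
    ∸-suc k n = trans (ℕP.∸-+-assoc n k 1) (cong (n ∸_) (ℕP.+-comm k 1))

  term-zero : ∀ n → ¬ α n ≡ 0ℚ → term b P 0 n ≡ 1ℚ
  term-zero n αn≢0 = begin
    term b P 0 n        ≡⟨ term≡ 0 n z≤n ⟩
    w 0 * (α n * ι n)   ≡⟨ cong₂ _*_ (sym w₀≡1) (ratio-chain a ((P ℕ.* n) !) a (n!≢0 (P ℕ.* n))) ⟨
    1ℚ * ratio a a      ≡⟨ ℚP.*-identityˡ (ratio a a) ⟩
    ratio a a           ≡⟨ ratio-self a a≢0 ⟩
    1ℚ                  ∎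
    where
    open ≡-Reasoning
    a = seqCount b (P ℕ.* n)
    a≢0 : ¬ a ≡ 0
    a≢0 a≡0 = αn≢0 (trans (cong (λ z → ratio z ((P ℕ.* n) !)) a≡0) (ratio-zero ((P ℕ.* n) !)))
    w₀≡1 : w 0 ≡ 1ℚ
    w₀≡1 = cong (λ z → ratio 1 (z !)) (ℕP.*-zeroʳ P)

  dCoef-one-zero : dCoef b P 1 0 ≡ 1ℚ
  dCoef-one-zero =
    trans (cong (λ N → fromℤ (ℤ.+ 1 ℤ.* ((ℤ.+ bpow b 0 N ℤ.- ℤ.+ 2 ℤ.* ℤ.+ bpow b 1 N) ℤ.+ ℤ.+ bpow b 2 N)))
                (ℕP.*-zeroʳ P))
          (cong₂ (λ y z → fromℤ (ℤ.+ 1 ℤ.* ((ℤ.+ 1 ℤ.- ℤ.+ 2 ℤ.* ℤ.+ y) ℤ.+ ℤ.+ z)))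
                 (trans (bpow-one 0) b₀≡0) (bpow-vanishes 2 0 (s≤s z≤n)))

  irrCoef≡dCoef : ∀ k → irrCoef b P (suc k) ≡ dCoef b P 1 (suc k)
  irrCoef≡dCoef k = sym (begin
    fromℤ (ℤ.+ 1 ℤ.* ((ℤ.+ 0 ℤ.- ℤ.+ 2 ℤ.* ℤ.+ bpow b 1 N) ℤ.+ ℤ.+ bpow b 2 N))
      ≡⟨ cong (λ y → fromℤ (ℤ.+ 1 ℤ.* ((ℤ.+ 0 ℤ.- ℤ.+ 2 ℤ.* ℤ.+ y) ℤ.+ ℤ.+ bpow b 2 N))) (bpow-one N) ⟩
    fromℤ (ℤ.+ 1 ℤ.* ((ℤ.+ 0 ℤ.- ℤ.+ 2 ℤ.* ℤ.+ b N) ℤ.+ ℤ.+ bpow b 2 N))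
      ≡⟨ cong fromℤ (negate (ℤ.+ 2 ℤ.* ℤ.+ b N) (ℤ.+ bpow b 2 N)) ⟩
    fromℤ (ℤ.- (ℤ.+ 2 ℤ.* ℤ.+ b N ℤ.- ℤ.+ bpow b 2 N))
      ≡⟨ fromℤ-neg (ℤ.+ 2 ℤ.* ℤ.+ b N ℤ.- ℤ.+ bpow b 2 N) ⟩
    irrCoef b P (suc k)
      ∎)
    where
    open ≡-Reasoning
    N = P ℕ.* suc k
    negate : ∀ x y → ℤ.+ 1 ℤ.* ((ℤ.+ 0 ℤ.- x) ℤ.+ y) ≡ ℤ.- (x ℤ.- y)
    negate = ℤ-Solver.solve-∀

  eventually-nonzero : ∃[ N ] (∀ n → N ℕ.≤ n → ¬ α n ≡ 0ℚ)
  eventually-nonzero = proj₁ garg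

  irreducible-expansion : ∀ r →
    BigO (λ n → probParts b P 1 n - sumℚ r (λ k → irrCoef b P k * irrTerm b P k n)) (irrTerm b P (suc r))
  irreducible-expansion r =
    O-cong N₀ (λ n N₀≤n → cong (λ z → probParts b P 1 n - z)
                               (sumℚ-cong r (λ k _ → same-terms n (α≢0 n N₀≤n) k)))
              (λ _ _ → refl) (probParts-expansion 1 r)
    where
    N₀ = proj₁ eventually-nonzero
    α≢0 = proj₂ eventually-nonzero
    same-terms : ∀ n → ¬ α n ≡ 0ℚ → ∀ k → dCoef b P 1 k * term b P k n ≡ irrCoef b P k * irrTerm b P k n
    same-terms n αn≢0 zero    = cong₂ _*_ dCoef-one-zero (term-zero n αn≢0)
    same-terms n αn≢0 (suc k) = cong (_* term b P (suc k) n) (sym (irrCoef≡dCoef k))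

  irrTerm-decreasing : ∀ k → LittleO (irrTerm b P (suc k)) (irrTerm b P k)
  irrTerm-decreasing zero    = o-cong (proj₁ eventually-nonzero) (λ _ _ → refl)
    (λ n N₀≤n → term-zero n (proj₂ eventually-nonzero n N₀≤n)) (term-decreasing 0)
  irrTerm-decreasing (suc k) = term-decreasing (suc k)

proposition5p1 : (b : ℕ → ℕ) → b 0 ≡ 0 →
    (p : ℕ) → 1 ℕ.≤ p →
    Periodic p (seqCount b) →
    Gargantuan (λ n → ratio (seqCount b (p ℕ.* n)) ((p ℕ.* n) !)) →
    ((m : ℕ) → 1 ℕ.≤ m → Approx (probParts b p m) (dCoef b p m) (term b p))
    × Approx (probParts b p 1) (irrCoef b p) (irrTerm b p)
proposition5p1 b b₀≡0 (suc p′) (s≤s z≤n) periodic garg =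
  (λ m _ → probParts-expansion m , term-decreasing) , (irreducible-expansion , irrTerm-decreasing)
  where open Asymptotics b b₀≡0 p′ periodic garg
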